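{- The map $\mathfrak{m}{\mathsf{WGraphs}}\to\overline{\widetilde\Lambda}$, $G\mapsto\overline X_{\overline G}$ (extended linearly to possibly infinite linear combinations), is a morphism of Hopf algebras.
   Context: Work over a field $\mathbb{K}$ of characteristic $0$. Weighted graph: finite simple graph with vertex weights $w:V(G)\to\{1,2,\dots\}$, up to weight-preserving isomorphism; $\overline G$ complement. $\overline X_G=\sum_\kappa\prod_v\prod_{i\in\kappa(v)}x_i^{w(v)}$ over proper set colorings $\kappa$ (nonempty color sets, disjoint on adjacent vertices). $\mathfrak{m}{\mathsf{WGraphs}}$ is the space of possibly infinite formal linear combinations of weighted graphs, with product disjoint union and coproduct $\blacktriangle G=\sum_{S\cup T=V(G)}G|_S\otimes G|_T$ (sum over pairs of possibly overlapping, possibly empty subsets with union $V(G)$). $\overline\Lambda$ is the completion of the Hopf algebra of symmetric functions (symmetric power series of unbounded degree) with the coproduct extended from $\Delta p_n=p_n\otimes1+1\otimes p_n$; it is known that $G\mapsto\overline X_G$ is a Hopf morphism $\mathfrak{m}{\mathsf{WGraphs}}\to\overline\Lambda$. $\overline{\widetilde\Lambda}$ is $\overline\Lambda$ with the same coproduct but product $\odot$ extending $\widetilde m_\lambda\odot\widetilde m_\mu=\widetilde m_{\lambda\sqcup\mu}$, where $\widetilde m_\lambda=m_\lambda\prod_ir_i(\lambda)!$ and $\lambda\sqcup\mu$ is the union of parts. -}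

module Defs where

open import Level using (Level; suc; _⊔_)
open import Algebra.Bundles using (CommutativeRing)
open import Data.Bool using (Bool; true; false; not; _∧_; _∨_; if_then_else_)
open import Data.Nat as ℕ using (ℕ; zero; _≤_; _≡ᵇ_; _≤ᵇ_)
import Data.Nat.Base
open import Data.Fin as Fin using (Fin; splitAt)
open import Data.Sum using (inj₁; inj₂)
open import Data.List as List using (List; []; _∷_; length; map; foldr; filter; zipWith; replicate; concatMap; allFin)
open import Data.Vec as Vec using (Vec; lookup)
open import Data.Product using (_×_; _,_; Σ; ∃)
open import Relation.Nullary using (¬_)
open import Data.List.Relation.Unary.All using (All)
open import Data.Bool.ListAction using (and; or; any; all)
open import Relation.Binary.PropositionalEquality using (_≡_; refl)

record Field (c ℓ : Level) : Set (Level.suc (c ⊔ ℓ)) where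
  field
    commutativeRing : CommutativeRing c ℓ
  open CommutativeRing commutativeRing public
  field
    1≉0     : ¬ (1# ≈ 0#)
    inverse : ∀ x → ¬ (x ≈ 0#) → Σ Carrier (λ y → (x * y) ≈ 1#)

module _ {c ℓ : Level} (K : Field c ℓ) where
  open Field K

  fromℕ : ℕ → Carrier
  fromℕ zero = 0#
  fromℕ (ℕ.suc n) = 1# + fromℕ n

  CharZero : Set ℓ
  CharZero = ∀ n → ¬ (fromℕ (ℕ.suc n) ≈ 0#)

  sumK : List Carrier → Carrier
  sumK = foldr _+_ 0#

record WGraph : Set where
  field
    n      : ℕ
    adj    : Fin n → Fin n → Bool
    sym    : ∀ u v → adj u v ≡ adj v u
    irrefl : ∀ v → adj v v ≡ false
    wt     : Fin n → ℕ
    wt-pos : ∀ v → 1 ≤ wt v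

open WGraph public

_=ᶠ_ : ∀ {n} → Fin n → Fin n → Bool
Fin.zero =ᶠ Fin.zero = true
Fin.zero =ᶠ Fin.suc _ = false
Fin.suc _ =ᶠ Fin.zero = false
Fin.suc a =ᶠ Fin.suc b = a =ᶠ b

=ᶠ-sym : ∀ {n} (a b : Fin n) → (a =ᶠ b) ≡ (b =ᶠ a)
=ᶠ-sym Fin.zero Fin.zero = refl
=ᶠ-sym Fin.zero (Fin.suc _) = refl
=ᶠ-sym (Fin.suc _) Fin.zero = refl
=ᶠ-sym (Fin.suc a) (Fin.suc b) = =ᶠ-sym a b

=ᶠ-refl : ∀ {n} (a : Fin n) → (a =ᶠ a) ≡ true
=ᶠ-refl Fin.zero = refl
=ᶠ-refl (Fin.suc a) = =ᶠ-refl a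

private
  cadj : ∀ {n} → (Fin n → Fin n → Bool) → Fin n → Fin n → Bool
  cadj a u v = if u =ᶠ v then false else not (a u v)

  cadj-sym : ∀ {n} (a : Fin n → Fin n → Bool) → (∀ u v → a u v ≡ a v u) →
             ∀ u v → cadj a u v ≡ cadj a v u
  cadj-sym a s u v with u =ᶠ v | v =ᶠ u | =ᶠ-sym u v
  ... | true  | .true  | refl = refl
  ... | false | .false | refl with a u v | a v u | s u v
  ...   | x | .x | refl = refl

  cadj-irr : ∀ {n} (a : Fin n → Fin n → Bool) → ∀ v → cadj a v v ≡ false
  cadj-irr a v with v =ᶠ v | =ᶠ-refl v
  ... | .true | refl = refl

complement : WGraph → WGraph
complement G = record
  { n = n G ; adj = cadj (adj G) ; sym = cadj-sym (adj G) (sym G)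
  ; irrefl = cadj-irr (adj G) ; wt = wt G ; wt-pos = wt-pos G }

-- disjoint union  G ⊔ H  on Fin (n G + n H)  (the product of 𝔪WGraphs)
private
  uadj : ∀ {m k} → (Fin m → Fin m → Bool) → (Fin k → Fin k → Bool) →
         Fin (m ℕ.+ k) → Fin (m ℕ.+ k) → Bool
  uadj {m} a b u v with splitAt m u | splitAt m v
  ... | inj₁ x | inj₁ y = a x y
  ... | inj₂ x | inj₂ y = b x y
  ... | inj₁ _ | inj₂ _ = false
  ... | inj₂ _ | inj₁ _ = false

  uadj-sym : ∀ {m k} (a : Fin m → Fin m → Bool) (b : Fin k → Fin k → Bool) →
             (∀ u v → a u v ≡ a v u) → (∀ u v → b u v ≡ b v u) →
             ∀ u v → uadj a b u v ≡ uadj a b v u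
  uadj-sym {m} a b sa sb u v with splitAt m u | splitAt m v
  ... | inj₁ x | inj₁ y = sa x y
  ... | inj₂ x | inj₂ y = sb x y
  ... | inj₁ _ | inj₂ _ = refl
  ... | inj₂ _ | inj₁ _ = refl

  uadj-irr : ∀ {m k} (a : Fin m → Fin m → Bool) (b : Fin k → Fin k → Bool) →
             (∀ v → a v v ≡ false) → (∀ v → b v v ≡ false) →
             ∀ v → uadj a b v v ≡ false
  uadj-irr {m} a b ia ib v with splitAt m v
  ... | inj₁ x = ia x
  ... | inj₂ x = ib x

  uwt : ∀ {m k} → (Fin m → ℕ) → (Fin k → ℕ) → Fin (m ℕ.+ k) → ℕ
  uwt {m} f g v with splitAt m v
  ... | inj₁ x = f x
  ... | inj₂ x = g x

  uwt-pos : ∀ {m k} (f : Fin m → ℕ) (g : Fin k → ℕ) → (∀ v → 1 ≤ f v) →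
            (∀ v → 1 ≤ g v) → ∀ v → 1 ≤ uwt f g v
  uwt-pos {m} f g pf pg v with splitAt m v
  ... | inj₁ x = pf x
  ... | inj₂ x = pg x

_⊎ᴳ_ : WGraph → WGraph → WGraph
G ⊎ᴳ H = record
  { n = n G ℕ.+ n H
  ; adj = uadj (adj G) (adj H)
  ; sym = uadj-sym (adj G) (adj H) (sym G) (sym H)
  ; irrefl = uadj-irr (adj G) (adj H) (irrefl G) (irrefl H)
  ; wt = uwt (wt G) (wt H)
  ; wt-pos = uwt-pos (wt G) (wt H) (wt-pos G) (wt-pos H) }

-- the empty graph (unit of 𝔪WGraphs)
emptyG : WGraph
emptyG = record { n = 0 ; adj = λ () ; sym = λ () ; irrefl = λ ()
                ; wt = λ () ; wt-pos = λ () }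

-- subsets of a list / of Fin n are encoded as boolean masks
masks : ℕ → List (List Bool)
masks zero = [] ∷ []
masks (ℕ.suc k) = concatMap (λ m → (true ∷ m) ∷ (false ∷ m) ∷ []) (masks k)

select : ∀ {A : Set} → List Bool → List A → List A
select (true ∷ bs) (x ∷ xs) = x ∷ select bs xs
select (false ∷ bs) (x ∷ xs) = select bs xs
select _ _ = []

induced : (G : WGraph) → List (Fin (n G)) → WGraph
induced G vs = record
  { n = length vs
  ; adj = λ i j → adj G (List.lookup vs i) (List.lookup vs j)
  ; sym = λ i j → sym G (List.lookup vs i) (List.lookup vs j)
  ; irrefl = λ i → irrefl G (List.lookup vs i)
  ; wt = λ i → wt G (List.lookup vs i)
  ; wt-pos = λ i → wt-pos G (List.lookup vs i) }

restrict : (G : WGraph) → List Bool → WGraph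
restrict G S = induced G (select S (allFin (n G)))

covers : ℕ → List (List Bool × List Bool)
covers k = filter (λ p → Data.Bool._≟_ (and (zipWith _∨_ (Data.Product.proj₁ p) (Data.Product.proj₂ p))) true)
                  (concatMap (λ S → map (λ T → (S , T)) (masks k)) (masks k))
  where import Data.Bool; import Data.Product

data Decreasing : List ℕ → Set where
  []  : Decreasing []
  [_] : ∀ a → Decreasing (a ∷ [])
  _∷_ : ∀ {a b l} → b ≤ a → Decreasing (b ∷ l) → Decreasing (a ∷ b ∷ l)

IsPartition : List ℕ → Set
IsPartition λs = Decreasing λs × All (λ a → 1 ≤ a) λs

insertD : ℕ → List ℕ → List ℕ
insertD a [] = a ∷ []
insertD a (b ∷ l) = if b ≤ᵇ a then a ∷ b ∷ l else b ∷ insertD a l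

_⊔ₚ_ : List ℕ → List ℕ → List ℕ
λs ⊔ₚ μs = foldr insertD μs λs

module Sym {c ℓ : Level} (K : Field c ℓ) where
  open Field K

  -- An element f of Λ̄ (a symmetric power series of unbounded degree) is
  -- recorded by its monomial-basis coefficients: f = Σ_λ f λ · m_λ,
  -- where only the values at partitions λ matter.
  Λ̄ : Set c
  Λ̄ = List ℕ → Carrier

  -- the completed tensor product Λ̄ ⊗̂ Λ̄ : coefficients of m_μ ⊗ m_ν
  Λ̄⊗Λ̄ : Set c
  Λ̄⊗Λ̄ = List ℕ → List ℕ → Carrier

  _≋_ : Λ̄ → Λ̄ → Set ℓ
  f ≋ g = ∀ λs → IsPartition λs → f λs ≈ g λs

  _≋₂_ : Λ̄⊗Λ̄ → Λ̄⊗Λ̄ → Set ℓ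
  F ≋₂ G = ∀ μs νs → IsPartition μs → IsPartition νs → F μs νs ≈ G μs νs

  one : Λ̄
  one [] = 1#
  one (_ ∷ _) = 0#

  counit : Λ̄ → Carrier
  counit f = f []

  -- coproduct (Δ p_n = p_n ⊗ 1 + 1 ⊗ p_n), i.e. Δ m_λ = Σ_{μ ⊔ ν = λ} m_μ ⊗ m_ν;
  -- hence the coefficient of m_μ ⊗ m_ν in Δ f is the coefficient of m_{μ⊔ν} in f.
  Δ : Λ̄ → Λ̄⊗Λ̄
  Δ f μs νs = f (μs ⊔ₚ νs)

  -- the product ⊙ of Λ̃̄, determined by  m̃_λ ⊙ m̃_μ = m̃_{λ⊔μ}
  -- with m̃_λ = m_λ ∏_i r_i(λ)!.  In the m-basis this reads
  --   (f ⊙ g)_ν = Σ_{λ ⊔ μ = ν} ∏_i binom(r_i(ν), r_i(λ)) f_λ g_μ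
  --            = Σ_{S ⊆ positions of ν} f_{ν|S} g_{ν|Sᶜ}.
  _⊙_ : Λ̄ → Λ̄ → Λ̄
  (f ⊙ g) νs = sumK K (map (λ S → f (select S νs) * g (select (map not S) νs))
                            (masks (length νs)))

  -- (Φ ⊗ Φ) applied to the coproduct  ▲G = Σ_{S ∪ T = V(G)} G|_S ⊗ G|_T
  tensorΣ : (G : WGraph) → (WGraph → Λ̄) → Λ̄⊗Λ̄
  tensorΣ G Φ μs νs =
    sumK K (map (λ p → Φ (restrict G (Data.Product.proj₁ p)) μs
                      * Φ (restrict G (Data.Product.proj₂ p)) νs)
                (covers (n G)))
    where import Data.Product

allVecs : ∀ {A : Set} (k : ℕ) → List A → List (Vec A k)
allVecs zero xs = Vec.[] ∷ []
allVecs (ℕ.suc k) xs = concatMap (λ x → map (x Vec.∷_) (allVecs k xs)) xs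

eqListℕ : List ℕ → List ℕ → Bool
eqListℕ [] [] = true
eqListℕ (a ∷ l) (b ∷ m) = (a ≡ᵇ b) ∧ eqListℕ l m
eqListℕ _ _ = false

-- A set coloring with colors {1,…,k}: κ v is the mask of κ(v) ⊆ {1..k}.
-- validColoring G α κ: κ(v) nonempty for all v, κ(u) ∩ κ(v) = ∅ for adjacent
-- u,v, and the monomial ∏_v ∏_{i∈κ(v)} x_i^{w(v)} equals x^α, i.e.
-- Σ_{v : i ∈ κ(v)} w(v) = α_i for each color i ≤ k = length α.
validColoring : (G : WGraph) → List ℕ → Vec (List Bool) (n G) → Bool
validColoring G α κ =
  all (λ v → or (lookup κ v)) (allFin (n G))
  ∧ all (λ u → all (λ v → not (adj G u v) ∨ not (or (zipWith _∧_ (lookup κ u) (lookup κ v))))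
                   (allFin (n G))) (allFin (n G))
  ∧ eqListℕ (foldr (λ v acc → zipWith ℕ._+_ (map (λ b → if b then wt G v else 0) (lookup κ v)) acc)
                   (replicate (length α) 0) (allFin (n G)))
            α

-- coefficient of the monomial x^α = x_1^{α_1} ⋯ x_k^{α_k} in X̄_G :
-- the number of proper set colorings κ of G with monomial x^α
-- (colors > k cannot occur, since every weight is ≥ 1).
XbarCoeff : WGraph → List ℕ → ℕ
XbarCoeff G α = length (filter (λ κ → Data.Bool._≟_ (validColoring G α κ) true)
                               (allVecs (n G) (masks (length α))))
  where import Data.Bool

module _ {c ℓ : Level} (K : Field c ℓ) where
  -- X̄_G ∈ Λ̄ in the monomial basis: coefficient of m_λ = coefficient of x^λ
  Xbar : WGraph → Sym.Λ̄ K
  Xbar G λs = fromℕ K (XbarCoeff G λs)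

  Φ : WGraph → Sym.Λ̄ K
  Φ G = Xbar (complement G)

{-# OPTIONS --safe #-}
-- Everything is proved for coefficients over ℕ and then pushed into K along the
-- semiring map k ↦ k · 1#.  The coefficient of x^α in X̄_Γ counts set colourings
-- of Γ with weight vector α.  Peeling off the first colour class writes it as a
-- sum over stable sets of weight α₁; this makes it symmetric in α (so the
-- coproduct coefficient at μ ⊔ ν may be computed at μ ++ ν), and, since a stable
-- set of the join Ḡ ∨ H̄ = complement (G ⊎ H) lies on one side, it yields the
-- ⊙-product formula.  A colouring with weights μ ++ ν splits into its first |μ|
-- and last |ν| colours; their supports S and T cover V(G), and colourings of Ḡ
-- with support exactly S are the colourings of the complement of G|_S that colour
-- every vertex.
module Submission where

open import Defs hiding (sym)
open import Level using (Level)
open import Algebra.Bundles using (CommutativeMonoid)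
open import Data.Bool using (Bool; true; false; not; _∧_; _∨_; if_then_else_; _≟_)
open import Data.Bool.Properties
  using (∧-assoc; ∧-zeroʳ; ∧-identityʳ; ∨-assoc; ∨-zeroʳ; ∨-identityʳ; ∨-distribˡ-∧; not-injective;
         ∧-commutativeMonoid; ∨-∧-booleanAlgebra)
open import Data.Bool.ListAction using (and; or; all)
open import Data.Bool.Solver using (module ∨-∧-Solver)
open import Data.Nat using (ℕ; zero; suc; _+_; _*_; _⊓_; _≤_; z≤n; s≤s; _≡ᵇ_; _≤ᵇ_)
open import Data.Nat.Properties
  using (+-assoc; +-identityʳ; *-identityˡ; *-zeroʳ; *-comm; *-assoc; *-distribˡ-+; *-distribʳ-+;
         suc-injective; ⊓-idem; m⊓n≤n; ≤-trans; ≤-reflexive; +-commutativeSemigroup; *-commutativeSemigroup)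
open import Data.Nat.Tactic.RingSolver using (solve-∀)
open import Data.Fin using (Fin; zero; suc; _↑ˡ_; _↑ʳ_)
open import Data.Fin.Properties using (splitAt-↑ˡ; splitAt-↑ʳ)
open import Data.List as List
  using (List; []; _∷_; _++_; map; concatMap; foldr; filter; length; replicate; tabulate; zipWith; zip; allFin)
open import Data.List.Properties
  using (length-map; length-replicate; length-zipWith; length-tabulate; length-++; map-++; map-replicate; zipWith-zeroʳ)
open import Data.List.Relation.Binary.Permutation.Propositional as ↭ using (_↭_)
open import Data.List.Relation.Unary.All using (All; []; _∷_)
open import Data.Product using (_×_; _,_; proj₁; proj₂; Σ-syntax)
open import Data.Vec as Vec using (Vec; lookup)
open import Data.Vec.Properties using (lookup-zipWith; lookup-replicate; lookup-++ˡ; lookup-++ʳ)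
import Data.Vec.Relation.Unary.All as VecAll
open import Data.Vec.Relation.Unary.All.Properties using (lookup⁺)
open import Function using (_∘_; id)
open import Relation.Binary.PropositionalEquality
open ≡-Reasoning
open import Algebra.Lattice.Properties.BooleanAlgebra ∨-∧-booleanAlgebra using (deMorgan₂)
open import Algebra.Properties.CommutativeSemigroup +-commutativeSemigroup
  using () renaming (interchange to +-interchange)
open import Algebra.Properties.CommutativeSemigroup *-commutativeSemigroup
  using () renaming (x∙yz≈y∙xz to *-exchange)
open import Algebra.Properties.CommutativeSemigroup (CommutativeMonoid.commutativeSemigroup ∧-commutativeMonoid)
  using () renaming (interchange to ∧-interchange; xy∙z≈xz∙y to ∧-exchange)

private variable
  A B C D M V : Set

infix 5 ∑
∑ : List A → (A → ℕ) → ℕ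
∑ []       f = 0
∑ (x ∷ xs) f = f x + ∑ xs f

syntax ∑ xs (λ x → e) = ∑[ x ∈ xs ] e

⟦_⟧ : Bool → ℕ
⟦ true  ⟧ = 1
⟦ false ⟧ = 0

⟦⟧-∧ : ∀ a b → ⟦ a ∧ b ⟧ ≡ ⟦ a ⟧ * ⟦ b ⟧
⟦⟧-∧ true  b = sym (+-identityʳ ⟦ b ⟧)
⟦⟧-∧ false b = refl

∑-cong : ∀ (xs : List A) {f g : A → ℕ} → (∀ x → f x ≡ g x) → ∑ xs f ≡ ∑ xs g
∑-cong []       f≗g = refl
∑-cong (x ∷ xs) f≗g = cong₂ _+_ (f≗g x) (∑-cong xs f≗g)

∑-++ : ∀ (xs ys : List A) f → ∑ (xs ++ ys) f ≡ ∑ xs f + ∑ ys f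
∑-++ []       ys f = refl
∑-++ (x ∷ xs) ys f = trans (cong (f x +_) (∑-++ xs ys f)) (sym (+-assoc (f x) _ _))

∑-map : ∀ (h : A → B) xs f → ∑ (map h xs) f ≡ ∑[ x ∈ xs ] f (h x)
∑-map h []       f = refl
∑-map h (x ∷ xs) f = cong (f (h x) +_) (∑-map h xs f)

∑-concatMap : ∀ (h : A → List B) xs f → ∑ (concatMap h xs) f ≡ ∑[ x ∈ xs ] ∑ (h x) f
∑-concatMap h []       f = refl
∑-concatMap h (x ∷ xs) f =
  trans (∑-++ (h x) (concatMap h xs) f) (cong (∑ (h x) f +_) (∑-concatMap h xs f))

∑-zero : ∀ (xs : List A) → ∑[ _ ∈ xs ] 0 ≡ 0
∑-zero []       = refl
∑-zero (x ∷ xs) = ∑-zero xs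

∑-distrib-+ : ∀ (xs : List A) f g → ∑[ x ∈ xs ] (f x + g x) ≡ ∑ xs f + ∑ xs g
∑-distrib-+ []       f g = refl
∑-distrib-+ (x ∷ xs) f g = begin
  f x + g x + ∑ xs (λ x → f x + g x)  ≡⟨ cong (f x + g x +_) (∑-distrib-+ xs f g) ⟩
  f x + g x + (∑ xs f + ∑ xs g)       ≡⟨ +-interchange (f x) (g x) (∑ xs f) (∑ xs g) ⟩
  f x + ∑ xs f + (g x + ∑ xs g)       ∎

∑-distribˡ : ∀ c (xs : List A) f → ∑[ x ∈ xs ] (c * f x) ≡ c * ∑ xs f
∑-distribˡ c []       f = sym (*-zeroʳ c)
∑-distribˡ c (x ∷ xs) f =
  trans (cong (c * f x +_) (∑-distribˡ c xs f)) (sym (*-distribˡ-+ c (f x) (∑ xs f)))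

∑-distribʳ : ∀ c (xs : List A) f → ∑[ x ∈ xs ] (f x * c) ≡ ∑ xs f * c
∑-distribʳ c xs f =
  trans (∑-cong xs (λ x → *-comm (f x) c)) (trans (∑-distribˡ c xs f) (*-comm c (∑ xs f)))

∑-⟦∧⟧ : ∀ (xs : List A) c (d : A → Bool) (g : A → ℕ) →
         ∑[ x ∈ xs ] (⟦ c ∧ d x ⟧ * g x) ≡ ⟦ c ⟧ * (∑[ x ∈ xs ] (⟦ d x ⟧ * g x))
∑-⟦∧⟧ xs c d g =
  trans (∑-cong xs λ x → trans (cong (_* g x) (⟦⟧-∧ c (d x))) (*-assoc ⟦ c ⟧ _ _)) (∑-distribˡ ⟦ c ⟧ xs _)

∑-swap : ∀ (xs : List A) (ys : List B) (f : A → B → ℕ) →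
         ∑[ x ∈ xs ] ∑[ y ∈ ys ] f x y ≡ ∑[ y ∈ ys ] ∑[ x ∈ xs ] f x y
∑-swap []       ys f = sym (∑-zero ys)
∑-swap (x ∷ xs) ys f = begin
  ∑ ys (f x) + ∑ xs (λ x → ∑ ys (f x))          ≡⟨ cong (∑ ys (f x) +_) (∑-swap xs ys f) ⟩
  ∑ ys (f x) + ∑ ys (λ y → ∑[ x ∈ xs ] f x y)   ≡⟨ ∑-distrib-+ ys (f x) _ ⟨
  ∑[ y ∈ ys ] (f x y + (∑[ x ∈ xs ] f x y))     ∎

∑-∑-swap : ∀ (as : List A) (bs : List B) (cs : List C) (ds : List D) (f : A → B → C → D → ℕ) →
  ∑[ a ∈ as ] ∑[ b ∈ bs ] ∑[ c ∈ cs ] ∑[ d ∈ ds ] f a b c d ≡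
  ∑[ c ∈ cs ] ∑[ d ∈ ds ] ∑[ a ∈ as ] ∑[ b ∈ bs ] f a b c d
∑-∑-swap as bs cs ds f = begin
  ∑[ a ∈ as ] ∑[ b ∈ bs ] ∑[ c ∈ cs ] ∑[ d ∈ ds ] f a b c d ≡⟨ ∑-cong as (λ a → ∑-swap bs cs _) ⟩
  ∑[ a ∈ as ] ∑[ c ∈ cs ] ∑[ b ∈ bs ] ∑[ d ∈ ds ] f a b c d ≡⟨ ∑-swap as cs _ ⟩
  ∑[ c ∈ cs ] ∑[ a ∈ as ] ∑[ b ∈ bs ] ∑[ d ∈ ds ] f a b c d ≡⟨ ∑-cong cs (λ c → ∑-cong as λ a → ∑-swap bs ds _) ⟩
  ∑[ c ∈ cs ] ∑[ a ∈ as ] ∑[ d ∈ ds ] ∑[ b ∈ bs ] f a b c d ≡⟨ ∑-cong cs (λ c → ∑-swap as ds _) ⟩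
  ∑[ c ∈ cs ] ∑[ d ∈ ds ] ∑[ a ∈ as ] ∑[ b ∈ bs ] f a b c d ∎

∑-*-∑ : ∀ (xs : List A) (ys : List B) (f : A → ℕ) (g : B → ℕ) →
        ∑ xs f * ∑ ys g ≡ ∑[ x ∈ xs ] ∑[ y ∈ ys ] (f x * g y)
∑-*-∑ xs ys f g = begin
  ∑ xs f * ∑ ys g                    ≡⟨ ∑-distribʳ (∑ ys g) xs f ⟨
  ∑[ x ∈ xs ] (f x * ∑ ys g)         ≡⟨ ∑-cong xs (λ x → ∑-distribˡ (f x) ys g) ⟨
  ∑[ x ∈ xs ] ∑[ y ∈ ys ] (f x * g y) ∎

∑-swap-factorʳ : ∀ (xs : List A) (ys : List B) (f : A → ℕ) (g : A → B → ℕ) (h : B → ℕ) →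
  ∑[ x ∈ xs ] (f x * (∑[ y ∈ ys ] (g x y * h y))) ≡ ∑[ y ∈ ys ] ((∑[ x ∈ xs ] (f x * g x y)) * h y)
∑-swap-factorʳ xs ys f g h = begin
  ∑[ x ∈ xs ] (f x * (∑[ y ∈ ys ] (g x y * h y)))   ≡⟨ ∑-cong xs (λ x → ∑-distribˡ (f x) ys _) ⟨
  ∑[ x ∈ xs ] ∑[ y ∈ ys ] (f x * (g x y * h y))     ≡⟨ ∑-swap xs ys _ ⟩
  ∑[ y ∈ ys ] ∑[ x ∈ xs ] (f x * (g x y * h y))     ≡⟨ ∑-cong ys (λ y → ∑-cong xs λ x → *-assoc (f x) _ _) ⟨
  ∑[ y ∈ ys ] ∑[ x ∈ xs ] (f x * g x y * h y)       ≡⟨ ∑-cong ys (λ y → ∑-distribʳ (h y) xs _) ⟩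
  ∑[ y ∈ ys ] ((∑[ x ∈ xs ] (f x * g x y)) * h y)   ∎

∑-swap-factorˡ : ∀ (xs : List A) (ys : List B) (f : A → ℕ) (g : A → B → ℕ) (h : B → ℕ) →
  ∑[ x ∈ xs ] (f x * (∑[ y ∈ ys ] (h y * g x y))) ≡ ∑[ y ∈ ys ] (h y * (∑[ x ∈ xs ] (f x * g x y)))
∑-swap-factorˡ xs ys f g h = begin
  ∑[ x ∈ xs ] (f x * (∑[ y ∈ ys ] (h y * g x y)))   ≡⟨ ∑-cong xs (λ x → ∑-distribˡ (f x) ys _) ⟨
  ∑[ x ∈ xs ] ∑[ y ∈ ys ] (f x * (h y * g x y))     ≡⟨ ∑-swap xs ys _ ⟩
  ∑[ y ∈ ys ] ∑[ x ∈ xs ] (f x * (h y * g x y))     ≡⟨ ∑-cong ys (λ y → ∑-cong xs λ x → *-exchange (f x) (h y) _) ⟩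
  ∑[ y ∈ ys ] ∑[ x ∈ xs ] (h y * (f x * g x y))     ≡⟨ ∑-cong ys (λ y → ∑-distribˡ (h y) xs _) ⟩
  ∑[ y ∈ ys ] (h y * (∑[ x ∈ xs ] (f x * g x y)))   ∎

∑-filter : ∀ (p : A → Bool) xs f →
           ∑ (filter (λ x → p x ≟ true) xs) f ≡ ∑[ x ∈ xs ] (⟦ p x ⟧ * f x)
∑-filter p []       f = refl
∑-filter p (x ∷ xs) f with p x
... | true  = cong₂ _+_ (sym (*-identityˡ (f x))) (∑-filter p xs f)
... | false = ∑-filter p xs f

length-filter : ∀ (p : A → Bool) xs → length (filter (λ x → p x ≟ true) xs) ≡ ∑[ x ∈ xs ] ⟦ p x ⟧
length-filter p []       = refl
length-filter p (x ∷ xs) with p x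
... | true  = cong suc (length-filter p xs)
... | false = length-filter p xs

allᶠ : ∀ n → (Fin n → Bool) → Bool
allᶠ zero    p = true
allᶠ (suc n) p = p zero ∧ allᶠ n (p ∘ suc)

foldrᶠ : ∀ n → (Fin n → B → B) → B → B
foldrᶠ zero    h z = z
foldrᶠ (suc n) h z = h zero (foldrᶠ n (h ∘ suc) z)

sumᶠ : ∀ n → (Fin n → ℕ) → ℕ
sumᶠ n f = foldrᶠ n (λ v → f v +_) 0

allᶠ-cong : ∀ n {p q : Fin n → Bool} → (∀ v → p v ≡ q v) → allᶠ n p ≡ allᶠ n q
allᶠ-cong zero    p≗q = refl
allᶠ-cong (suc n) p≗q = cong₂ _∧_ (p≗q zero) (allᶠ-cong n (p≗q ∘ suc))

sumᶠ-cong : ∀ n {f g : Fin n → ℕ} → (∀ v → f v ≡ g v) → sumᶠ n f ≡ sumᶠ n g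
sumᶠ-cong zero    f≗g = refl
sumᶠ-cong (suc n) f≗g = cong₂ _+_ (f≗g zero) (sumᶠ-cong n (f≗g ∘ suc))

foldrᶠ-cong : ∀ n {h h′ : Fin n → B → B} z → (∀ v b → h v b ≡ h′ v b) →
              foldrᶠ n h z ≡ foldrᶠ n h′ z
foldrᶠ-cong zero    z h≗h′ = refl
foldrᶠ-cong (suc n) {h} z h≗h′ =
  trans (cong (h zero) (foldrᶠ-cong n z (h≗h′ ∘ suc))) (h≗h′ zero _)

foldrᶠ-fixed : ∀ n {h : Fin n → B → B} {z} → (∀ v → h v z ≡ z) → foldrᶠ n h z ≡ z
foldrᶠ-fixed zero    fixed = refl
foldrᶠ-fixed (suc n) {h} fixed = trans (cong (h zero) (foldrᶠ-fixed n (fixed ∘ suc))) (fixed zero)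

foldrᶠ-preserves : ∀ n {P : B → Set} {h : Fin n → B → B} {z} →
                   (∀ v {acc} → P acc → P (h v acc)) → P z → P (foldrᶠ n h z)
foldrᶠ-preserves zero    step base = base
foldrᶠ-preserves (suc n) step base = step zero (foldrᶠ-preserves n (step ∘ suc) base)

allᶠ-∧ : ∀ n (p q : Fin n → Bool) → allᶠ n (λ v → p v ∧ q v) ≡ allᶠ n p ∧ allᶠ n q
allᶠ-∧ zero    p q = refl
allᶠ-∧ (suc n) p q =
  trans (cong ((p zero ∧ q zero) ∧_) (allᶠ-∧ n (p ∘ suc) (q ∘ suc)))
        (∧-interchange (p zero) (q zero) _ _)

allᶠ-+ : ∀ m k (p : Fin (m + k) → Bool) →
         allᶠ (m + k) p ≡ allᶠ m (λ v → p (v ↑ˡ k)) ∧ allᶠ k (λ v → p (m ↑ʳ v))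
allᶠ-+ zero    k p = refl
allᶠ-+ (suc m) k p =
  trans (cong (p zero ∧_) (allᶠ-+ m k (p ∘ suc))) (sym (∧-assoc (p zero) _ _))

sumᶠ-+ : ∀ m k (f : Fin (m + k) → ℕ) →
         sumᶠ (m + k) f ≡ sumᶠ m (λ v → f (v ↑ˡ k)) + sumᶠ k (λ v → f (m ↑ʳ v))
sumᶠ-+ zero    k f = refl
sumᶠ-+ (suc m) k f =
  trans (cong (f zero +_) (sumᶠ-+ m k (f ∘ suc))) (sym (+-assoc (f zero) _ _))

sumᶠ-zero : ∀ n {f : Fin n → ℕ} → (∀ v → f v ≡ 0) → sumᶠ n f ≡ 0
sumᶠ-zero zero    f≗0 = refl
sumᶠ-zero (suc n) f≗0 = cong₂ _+_ (f≗0 zero) (sumᶠ-zero n (f≗0 ∘ suc))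

allᶠ-true : ∀ n {p : Fin n → Bool} → (∀ v → p v ≡ true) → allᶠ n p ≡ true
allᶠ-true zero    p≗true = refl
allᶠ-true (suc n) p≗true = cong₂ _∧_ (p≗true zero) (allᶠ-true n (p≗true ∘ suc))

allᶠ-true⁻ : ∀ n {p : Fin n → Bool} → allᶠ n p ≡ true → ∀ v → p v ≡ true
allᶠ-true⁻ (suc n) {p} all≡true v with p zero in p₀≡true
allᶠ-true⁻ (suc n) all≡true zero    | true = p₀≡true
allᶠ-true⁻ (suc n) all≡true (suc v) | true = allᶠ-true⁻ n all≡true v

allᶠ-false : ∀ n {p : Fin n → Bool} v → p v ≡ false → allᶠ n p ≡ false
allᶠ-false (suc n) {p} zero pv≡false = cong (_∧ allᶠ n (p ∘ suc)) pv≡false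
allᶠ-false (suc n) {p} (suc v) pv≡false =
  trans (cong (p zero ∧_) (allᶠ-false n v pv≡false)) (∧-zeroʳ (p zero))

allᶠ-false⁻ : ∀ n {p : Fin n → Bool} → allᶠ n p ≡ false → Σ[ v ∈ Fin n ] p v ≡ false
allᶠ-false⁻ (suc n) {p} all≡false with p zero in p₀≡
... | false = zero , p₀≡
... | true  with allᶠ-false⁻ n all≡false
...   | v , pv≡false = suc v , pv≡false

all-tabulate : ∀ n (p : A → Bool) (g : Fin n → A) → all p (tabulate g) ≡ allᶠ n (p ∘ g)
all-tabulate zero    p g = refl
all-tabulate (suc n) p g = cong (p (g zero) ∧_) (all-tabulate n p (g ∘ suc))

foldr-tabulate : ∀ n (h : A → B → B) z (g : Fin n → A) →
                 foldr h z (tabulate g) ≡ foldrᶠ n (h ∘ g) z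
foldr-tabulate zero    h z g = refl
foldr-tabulate (suc n) h z g = cong (h (g zero)) (foldr-tabulate n h z (g ∘ suc))

isEmpty : ∀ {p} → Vec Bool p → Bool
isEmpty {p} C = allᶠ p (not ∘ lookup C)

isEmpty-lookup : ∀ {p} (C : Vec Bool p) → isEmpty C ≡ true → ∀ v → lookup C v ≡ false
isEmpty-lookup C C-empty v = not-injective (allᶠ-true⁻ _ C-empty v)

booleans : List Bool
booleans = true ∷ false ∷ []

∑-masks-suc : ∀ k (g : List Bool → ℕ) →
              ∑ (masks (suc k)) g ≡ ∑[ b ∈ booleans ] ∑[ m ∈ masks k ] g (b ∷ m)
∑-masks-suc k g = begin
  ∑ (masks (suc k)) g
    ≡⟨ ∑-concatMap _ (masks k) g ⟩
  ∑[ m ∈ masks k ] (g (true ∷ m) + (g (false ∷ m) + 0))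
    ≡⟨ ∑-cong (masks k) (λ m → cong (g (true ∷ m) +_) (+-identityʳ _)) ⟩
  ∑[ m ∈ masks k ] (g (true ∷ m) + g (false ∷ m))
    ≡⟨ ∑-distrib-+ (masks k) _ _ ⟩
  ∑ (masks k) (λ m → g (true ∷ m)) + ∑ (masks k) (λ m → g (false ∷ m))
    ≡⟨ cong (∑ (masks k) (λ m → g (true ∷ m)) +_) (+-identityʳ _) ⟨
  ∑[ b ∈ booleans ] ∑[ m ∈ masks k ] g (b ∷ m) ∎

∑-masks-+ : ∀ a b (g : List Bool → ℕ) →
            ∑ (masks (a + b)) g ≡ ∑[ S ∈ masks a ] ∑[ T ∈ masks b ] g (S ++ T)
∑-masks-+ zero    b g = sym (+-identityʳ _)
∑-masks-+ (suc a) b g = begin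
  ∑ (masks (suc (a + b))) g
    ≡⟨ ∑-masks-suc (a + b) g ⟩
  ∑[ c ∈ booleans ] ∑[ m ∈ masks (a + b) ] g (c ∷ m)
    ≡⟨ ∑-cong booleans (λ c → ∑-masks-+ a b (λ m → g (c ∷ m))) ⟩
  ∑[ c ∈ booleans ] ∑[ S ∈ masks a ] ∑[ T ∈ masks b ] g (c ∷ S ++ T)
    ≡⟨ ∑-masks-suc a _ ⟨
  ∑[ S ∈ masks (suc a) ] ∑[ T ∈ masks b ] g (S ++ T) ∎

∑-masks-cong : ∀ k {f g : List Bool → ℕ} → (∀ m → length m ≡ k → f m ≡ g m) →
               ∑ (masks k) f ≡ ∑ (masks k) g
∑-masks-cong zero    f≗g = cong (_+ 0) (f≗g [] refl)
∑-masks-cong (suc k) {f} {g} f≗g = begin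
  ∑ (masks (suc k)) f
    ≡⟨ ∑-masks-suc k f ⟩
  ∑[ b ∈ booleans ] ∑[ m ∈ masks k ] f (b ∷ m)
    ≡⟨ ∑-cong booleans (λ b → ∑-masks-cong k (λ m ∣m∣≡k → f≗g (b ∷ m) (cong suc ∣m∣≡k))) ⟩
  ∑[ b ∈ booleans ] ∑[ m ∈ masks k ] g (b ∷ m)
    ≡⟨ ∑-masks-suc k g ⟨
  ∑ (masks (suc k)) g ∎

∑-masks-empty : ∀ k (g : List Bool → ℕ) →
                ∑[ m ∈ masks k ] (⟦ not (or m) ⟧ * g m) ≡ g (replicate k false)
∑-masks-empty zero    g = trans (+-identityʳ _) (+-identityʳ _)
∑-masks-empty (suc k) g = begin
  ∑[ m ∈ masks (suc k) ] (⟦ not (or m) ⟧ * g m)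
    ≡⟨ ∑-masks-suc k _ ⟩
  (∑[ m ∈ masks k ] 0) + ((∑[ m ∈ masks k ] (⟦ not (or m) ⟧ * g (false ∷ m))) + 0)
    ≡⟨ cong₂ _+_ (∑-zero (masks k)) (+-identityʳ _) ⟩
  ∑[ m ∈ masks k ] (⟦ not (or m) ⟧ * g (false ∷ m))
    ≡⟨ ∑-masks-empty k (λ m → g (false ∷ m)) ⟩
  g (replicate (suc k) false) ∎

∑-allVecs-∷ : ∀ n (zs : List A) (f : Vec A (suc n) → ℕ) →
              ∑ (allVecs (suc n) zs) f ≡ ∑[ z ∈ zs ] ∑[ κ ∈ allVecs n zs ] f (z Vec.∷ κ)
∑-allVecs-∷ n zs f =
  trans (∑-concatMap _ zs f) (∑-cong zs (λ z → ∑-map (z Vec.∷_) (allVecs n zs) f))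

∑-allVecs-++ : ∀ m k (zs : List A) (f : Vec A (m + k) → ℕ) →
               ∑ (allVecs (m + k) zs) f ≡
               ∑[ κ₁ ∈ allVecs m zs ] ∑[ κ₂ ∈ allVecs k zs ] f (κ₁ Vec.++ κ₂)
∑-allVecs-++ zero    k zs f = sym (+-identityʳ _)
∑-allVecs-++ (suc m) k zs f = begin
  ∑ (allVecs (suc (m + k)) zs) f
    ≡⟨ ∑-allVecs-∷ (m + k) zs f ⟩
  ∑[ z ∈ zs ] ∑[ κ ∈ allVecs (m + k) zs ] f (z Vec.∷ κ)
    ≡⟨ ∑-cong zs (λ z → ∑-allVecs-++ m k zs (λ κ → f (z Vec.∷ κ))) ⟩
  ∑[ z ∈ zs ] ∑[ κ₁ ∈ allVecs m zs ] ∑[ κ₂ ∈ allVecs k zs ] f (z Vec.∷ (κ₁ Vec.++ κ₂))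
    ≡⟨ ∑-allVecs-∷ m zs _ ⟨
  ∑[ κ₁ ∈ allVecs (suc m) zs ] ∑[ κ₂ ∈ allVecs k zs ] f (κ₁ Vec.++ κ₂) ∎

∑-allVecs-zipWith : ∀ (zs : List A) (bs : List B) (ms : List M) (h : B → M → A) →
  (∀ (g : A → ℕ) → ∑ zs g ≡ ∑[ b ∈ bs ] ∑[ m ∈ ms ] g (h b m)) →
  ∀ n (f : Vec A n → ℕ) →
  ∑ (allVecs n zs) f ≡ ∑[ C ∈ allVecs n bs ] ∑[ κ ∈ allVecs n ms ] f (Vec.zipWith h C κ)
∑-allVecs-zipWith zs bs ms h ∑zs zero    f = sym (+-identityʳ _)
∑-allVecs-zipWith zs bs ms h ∑zs (suc n) f = begin
  ∑ (allVecs (suc n) zs) f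
    ≡⟨ ∑-allVecs-∷ n zs f ⟩
  ∑[ z ∈ zs ] ∑[ κ ∈ allVecs n zs ] f (z Vec.∷ κ)
    ≡⟨ ∑-cong zs (λ z → ∑-allVecs-zipWith zs bs ms h ∑zs n (λ κ → f (z Vec.∷ κ))) ⟩
  ∑[ z ∈ zs ] ∑[ C ∈ allVecs n bs ] ∑[ κ ∈ allVecs n ms ] f (z Vec.∷ Vec.zipWith h C κ)
    ≡⟨ ∑zs _ ⟩
  ∑[ b ∈ bs ] ∑[ m ∈ ms ] ∑[ C ∈ allVecs n bs ] ∑[ κ ∈ allVecs n ms ] f (h b m Vec.∷ Vec.zipWith h C κ)
    ≡⟨ ∑-cong bs (λ b → ∑-swap ms (allVecs n bs) _) ⟩
  ∑[ b ∈ bs ] ∑[ C ∈ allVecs n bs ] ∑[ m ∈ ms ] ∑[ κ ∈ allVecs n ms ] f (h b m Vec.∷ Vec.zipWith h C κ)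
    ≡⟨ ∑-cong bs (λ b → ∑-cong (allVecs n bs) (λ C → ∑-allVecs-∷ n ms _)) ⟨
  ∑[ b ∈ bs ] ∑[ C ∈ allVecs n bs ] ∑[ κ ∈ allVecs (suc n) ms ] f (Vec.zipWith h (b Vec.∷ C) κ)
    ≡⟨ ∑-allVecs-∷ n bs _ ⟨
  ∑[ C ∈ allVecs (suc n) bs ] ∑[ κ ∈ allVecs (suc n) ms ] f (Vec.zipWith h C κ) ∎

∑-allVecs-singleton : ∀ n (x : A) (f : Vec A n → ℕ) →
                      ∑ (allVecs n (x ∷ [])) f ≡ f (Vec.replicate n x)
∑-allVecs-singleton zero    x f = +-identityʳ _
∑-allVecs-singleton (suc n) x f =
  trans (∑-allVecs-∷ n (x ∷ []) f)
        (trans (+-identityʳ _) (∑-allVecs-singleton n x (λ κ → f (x Vec.∷ κ))))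

∑-allVecs-masks-cong : ∀ n k {f g : Vec (List Bool) n → ℕ} →
  (∀ κ → VecAll.All (λ m → length m ≡ k) κ → f κ ≡ g κ) →
  ∑ (allVecs n (masks k)) f ≡ ∑ (allVecs n (masks k)) g
∑-allVecs-masks-cong zero    k f≗g = cong (_+ 0) (f≗g Vec.[] VecAll.[])
∑-allVecs-masks-cong (suc n) k {f} {g} f≗g = begin
  ∑ (allVecs (suc n) (masks k)) f
    ≡⟨ ∑-allVecs-∷ n (masks k) f ⟩
  ∑[ m ∈ masks k ] ∑[ κ ∈ allVecs n (masks k) ] f (m Vec.∷ κ)
    ≡⟨ ∑-masks-cong k (λ m ∣m∣≡k →
         ∑-allVecs-masks-cong n k (λ κ lengths → f≗g (m Vec.∷ κ) (∣m∣≡k VecAll.∷ lengths))) ⟩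
  ∑[ m ∈ masks k ] ∑[ κ ∈ allVecs n (masks k) ] g (m Vec.∷ κ)
    ≡⟨ ∑-allVecs-∷ n (masks k) g ⟨
  ∑ (allVecs (suc n) (masks k)) g ∎

∑-classes-empty : ∀ p (g : Vec Bool p → ℕ) →
                  ∑[ C ∈ allVecs p booleans ] (⟦ isEmpty C ⟧ * g C) ≡ g (Vec.replicate p false)
∑-classes-empty zero    g = trans (+-identityʳ _) (+-identityʳ _)
∑-classes-empty (suc p) g = begin
  ∑[ C ∈ allVecs (suc p) booleans ] (⟦ isEmpty C ⟧ * g C)
    ≡⟨ ∑-allVecs-∷ p booleans _ ⟩
  (∑[ C ∈ allVecs p booleans ] 0) + ((∑[ C ∈ allVecs p booleans ] (⟦ isEmpty C ⟧ * g (false Vec.∷ C))) + 0)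
    ≡⟨ cong₂ _+_ (∑-zero (allVecs p booleans)) (+-identityʳ _) ⟩
  ∑[ C ∈ allVecs p booleans ] (⟦ isEmpty C ⟧ * g (false Vec.∷ C))
    ≡⟨ ∑-classes-empty p (λ C → g (false Vec.∷ C)) ⟩
  g (Vec.replicate (suc p) false) ∎

hasSupport : ∀ {p} → List Bool → Vec (List Bool) p → Bool
hasSupport []          Vec.[]      = true
hasSupport (true ∷ S)  (m Vec.∷ κ) = or m ∧ hasSupport S κ
hasSupport (false ∷ S) (m Vec.∷ κ) = not (or m) ∧ hasSupport S κ
hasSupport _           _           = false

support : ∀ {p} → Vec (List Bool) p → List Bool
support κ = Vec.toList (Vec.map or κ)

∑-masks-hasSupport : ∀ {p} (κ : Vec (List Bool) p) (g : List Bool → ℕ) →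
                     ∑[ S ∈ masks p ] (⟦ hasSupport S κ ⟧ * g S) ≡ g (support κ)
∑-masks-hasSupport Vec.[]      g = trans (+-identityʳ _) (+-identityʳ _)
∑-masks-hasSupport {suc p} (m Vec.∷ κ) g = trans (∑-masks-suc p _) (step (or m))
  where
  step : ∀ b → (∑[ S ∈ masks p ] (⟦ b ∧ hasSupport S κ ⟧ * g (true ∷ S))) +
               ((∑[ S ∈ masks p ] (⟦ not b ∧ hasSupport S κ ⟧ * g (false ∷ S))) + 0) ≡
               g (b ∷ support κ)
  step true  = trans (cong₂ _+_ (∑-masks-hasSupport κ (g ∘ (true ∷_))) (cong (_+ 0) (∑-zero (masks p))))
                     (+-identityʳ _)
  step false = trans (cong₂ _+_ (∑-zero (masks p)) (+-identityʳ _)) (∑-masks-hasSupport κ (g ∘ (false ∷_)))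

jointlyCover : List Bool → List Bool → Bool
jointlyCover S T = and (zipWith _∨_ S T)

∑-covers : ∀ p (g : List Bool × List Bool → ℕ) →
           ∑ (covers p) g ≡ ∑[ S ∈ masks p ] ∑[ T ∈ masks p ] (⟦ jointlyCover S T ⟧ * g (S , T))
∑-covers p g = begin
  ∑ (covers p) g
    ≡⟨ ∑-filter (λ (S , T) → jointlyCover S T) pairs g ⟩
  ∑[ q ∈ pairs ] (⟦ jointlyCover (proj₁ q) (proj₂ q) ⟧ * g q)
    ≡⟨ ∑-concatMap (λ S → map (S ,_) (masks p)) (masks p) _ ⟩
  ∑[ S ∈ masks p ] ∑ (map (S ,_) (masks p)) (λ q → ⟦ jointlyCover (proj₁ q) (proj₂ q) ⟧ * g q)
    ≡⟨ ∑-cong (masks p) (λ S → ∑-map (S ,_) (masks p) _) ⟩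
  ∑[ S ∈ masks p ] ∑[ T ∈ masks p ] (⟦ jointlyCover S T ⟧ * g (S , T)) ∎
  where
  pairs = concatMap (λ S → map (S ,_) (masks p)) (masks p)

∑-covers-cong : ∀ p {f g : List Bool × List Bool → ℕ} →
                (∀ S T → length S ≡ p → length T ≡ p → f (S , T) ≡ g (S , T)) →
                ∑ (covers p) f ≡ ∑ (covers p) g
∑-covers-cong p {f} {g} f≗g = begin
  ∑ (covers p) f
    ≡⟨ ∑-covers p f ⟩
  ∑[ S ∈ masks p ] ∑[ T ∈ masks p ] (⟦ jointlyCover S T ⟧ * f (S , T))
    ≡⟨ ∑-masks-cong p (λ S ∣S∣ → ∑-masks-cong p λ T ∣T∣ →
         cong (⟦ jointlyCover S T ⟧ *_) (f≗g S T ∣S∣ ∣T∣)) ⟩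
  ∑[ S ∈ masks p ] ∑[ T ∈ masks p ] (⟦ jointlyCover S T ⟧ * g (S , T))
    ≡⟨ ∑-covers p g ⟨
  ∑ (covers p) g ∎

disjoint : List Bool → List Bool → Bool
disjoint x y = not (or (zipWith _∧_ x y))

or-++ : ∀ x y → or (x ++ y) ≡ or x ∨ or y
or-++ []      y = refl
or-++ (b ∷ x) y = trans (cong (b ∨_) (or-++ x y)) (sym (∨-assoc b (or x) (or y)))

zipWith-++ : ∀ (f : A → B → C) x₁ x₂ y₁ y₂ → length x₁ ≡ length y₁ →
             zipWith f (x₁ ++ x₂) (y₁ ++ y₂) ≡ zipWith f x₁ y₁ ++ zipWith f x₂ y₂
zipWith-++ f []       x₂ []       y₂ _  = refl
zipWith-++ f (x ∷ x₁) x₂ (y ∷ y₁) y₂ eq = cong (f x y ∷_) (zipWith-++ f x₁ x₂ y₁ y₂ (suc-injective eq))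

disjoint-++ : ∀ x₁ x₂ y₁ y₂ → length x₁ ≡ length y₁ →
              disjoint (x₁ ++ x₂) (y₁ ++ y₂) ≡ disjoint x₁ y₁ ∧ disjoint x₂ y₂
disjoint-++ x₁ x₂ y₁ y₂ eq = begin
  not (or (zipWith _∧_ (x₁ ++ x₂) (y₁ ++ y₂)))
    ≡⟨ cong (not ∘ or) (zipWith-++ _∧_ x₁ x₂ y₁ y₂ eq) ⟩
  not (or (zipWith _∧_ x₁ y₁ ++ zipWith _∧_ x₂ y₂))
    ≡⟨ cong not (or-++ (zipWith _∧_ x₁ y₁) _) ⟩
  not (or (zipWith _∧_ x₁ y₁) ∨ or (zipWith _∧_ x₂ y₂))
    ≡⟨ deMorgan₂ (or (zipWith _∧_ x₁ y₁)) _ ⟩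
  disjoint x₁ y₁ ∧ disjoint x₂ y₂ ∎

disjoint-emptyʳ : ∀ k x → disjoint x (replicate k false) ≡ true
disjoint-emptyʳ zero    []      = refl
disjoint-emptyʳ zero    (_ ∷ _) = refl
disjoint-emptyʳ (suc k) []      = refl
disjoint-emptyʳ (suc k) (b ∷ x) =
  trans (cong (λ c → not (c ∨ or (zipWith _∧_ x (replicate k false)))) (∧-zeroʳ b)) (disjoint-emptyʳ k x)

disjoint-emptyˡ : ∀ k y → disjoint (replicate k false) y ≡ true
disjoint-emptyˡ zero    y       = refl
disjoint-emptyˡ (suc k) []      = refl
disjoint-emptyˡ (suc k) (_ ∷ y) = disjoint-emptyˡ k y

replicate-+ : ∀ a b {x : A} → replicate (a + b) x ≡ replicate a x ++ replicate b x
replicate-+ zero    b = refl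
replicate-+ (suc a) b = cong (_ ∷_) (replicate-+ a b)

eqListℕ-++ : ∀ x₁ x₂ μ ν → length x₁ ≡ length μ →
             eqListℕ (x₁ ++ x₂) (μ ++ ν) ≡ eqListℕ x₁ μ ∧ eqListℕ x₂ ν
eqListℕ-++ []       x₂ []      ν _  = refl
eqListℕ-++ (x ∷ x₁) x₂ (y ∷ μ) ν eq =
  trans (cong ((x ≡ᵇ y) ∧_) (eqListℕ-++ x₁ x₂ μ ν (suc-injective eq))) (sym (∧-assoc (x ≡ᵇ y) _ _))

zipWith-+-zerosˡ : ∀ k acc → length acc ≤ k → zipWith _+_ (replicate k 0) acc ≡ acc
zipWith-+-zerosˡ zero    []        _         = refl
zipWith-+-zerosˡ (suc k) []        _         = refl
zipWith-+-zerosˡ (suc k) (x ∷ acc) (s≤s ∣acc∣≤k) = cong (x ∷_) (zipWith-+-zerosˡ k acc ∣acc∣≤k)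

length-addRow : ∀ (f : Bool → ℕ) m acc {a} → length m ≡ a → length acc ≡ a →
                length (zipWith _+_ (map f m) acc) ≡ a
length-addRow f m acc {a} ∣m∣≡a ∣acc∣≡a = begin
  length (zipWith _+_ (map f m) acc) ≡⟨ length-zipWith _+_ (map f m) acc ⟩
  length (map f m) ⊓ length acc      ≡⟨ cong₂ _⊓_ (trans (length-map f m) ∣m∣≡a) ∣acc∣≡a ⟩
  a ⊓ a                              ≡⟨ ⊓-idem a ⟩
  a                                  ∎

foldrᶠ-zipWith-∷ : ∀ n (f : Fin n → Bool → ℕ) (c : Fin n → Bool) (m : Fin n → List Bool) z zs →
  foldrᶠ n (λ v → zipWith _+_ (map (f v) (c v ∷ m v))) (z ∷ zs) ≡
  foldrᶠ n (λ v → f v (c v) +_) z ∷ foldrᶠ n (λ v → zipWith _+_ (map (f v) (m v))) zs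
foldrᶠ-zipWith-∷ zero    f c m z zs = refl
foldrᶠ-zipWith-∷ (suc n) f c m z zs =
  cong (zipWith _+_ (map (f zero) (c zero ∷ m zero))) (foldrᶠ-zipWith-∷ n (f ∘ suc) (c ∘ suc) (m ∘ suc) z zs)

foldrᶠ-zipWith-++ : ∀ n (f : Fin n → Bool → ℕ) (m₁ m₂ : Fin n → List Bool) {a} z₁ z₂ →
  (∀ v → length (m₁ v) ≡ a) → length z₁ ≡ a →
  foldrᶠ n (λ v → zipWith _+_ (map (f v) (m₁ v ++ m₂ v))) (z₁ ++ z₂) ≡
  foldrᶠ n (λ v → zipWith _+_ (map (f v) (m₁ v))) z₁ ++ foldrᶠ n (λ v → zipWith _+_ (map (f v) (m₂ v))) z₂
foldrᶠ-zipWith-++ zero    f m₁ m₂ z₁ z₂ ∣m₁∣≡a ∣z₁∣≡a = refl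
foldrᶠ-zipWith-++ (suc n) f m₁ m₂ {a} z₁ z₂ ∣m₁∣≡a ∣z₁∣≡a = begin
  zipWith _+_ (map (f zero) (m₁ zero ++ m₂ zero)) (foldrᶠ n _ (z₁ ++ z₂))
    ≡⟨ cong₂ (zipWith _+_) (map-++ (f zero) (m₁ zero) (m₂ zero))
             (foldrᶠ-zipWith-++ n (f ∘ suc) (m₁ ∘ suc) (m₂ ∘ suc) z₁ z₂ (∣m₁∣≡a ∘ suc) ∣z₁∣≡a) ⟩
  zipWith _+_ (map (f zero) (m₁ zero) ++ map (f zero) (m₂ zero)) (rest₁ ++ rest₂)
    ≡⟨ zipWith-++ _+_ (map (f zero) (m₁ zero)) _ rest₁ _
         (trans (trans (length-map (f zero) (m₁ zero)) (∣m₁∣≡a zero)) (sym ∣rest₁∣≡a)) ⟩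
  zipWith _+_ (map (f zero) (m₁ zero)) rest₁ ++ zipWith _+_ (map (f zero) (m₂ zero)) rest₂ ∎
  where
  rest₁ = foldrᶠ n (λ v → zipWith _+_ (map (f (suc v)) (m₁ (suc v)))) z₁
  rest₂ = foldrᶠ n (λ v → zipWith _+_ (map (f (suc v)) (m₂ (suc v)))) z₂
  ∣rest₁∣≡a : length rest₁ ≡ a
  ∣rest₁∣≡a = foldrᶠ-preserves n {P = λ acc → length acc ≡ a}
    (λ v → length-addRow (f (suc v)) (m₁ (suc v)) _ (∣m₁∣≡a (suc v))) ∣z₁∣≡a

jointlyCover-support : ∀ {p} (κ₁ κ₂ : Vec (List Bool) p) →
  jointlyCover (support κ₁) (support κ₂) ≡ allᶠ p (λ v → or (lookup κ₁ v) ∨ or (lookup κ₂ v))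
jointlyCover-support Vec.[]        Vec.[]        = refl
jointlyCover-support (m₁ Vec.∷ κ₁) (m₂ Vec.∷ κ₂) = cong ((or m₁ ∨ or m₂) ∧_) (jointlyCover-support κ₁ κ₂)

-- Counting set colourings

everyVertex : ∀ {n} → Fin n → Bool
everyVertex _ = true

-- A set colouring with k colours is a vector κ of masks of length k (κ v ⊆ {1..k}).
-- R marks the vertices whose colour set must be nonempty; relaxing this
-- condition lets the first colour class be peeled off recursively.
module Colourings {n : ℕ} (E : Fin n → Fin n → Bool) (w : Fin n → ℕ) where

  nonemptyOn : (Fin n → Bool) → Vec (List Bool) n → Bool
  nonemptyOn R κ = allᶠ n (λ v → not (R v) ∨ or (lookup κ v))

  proper : Vec (List Bool) n → Bool
  proper κ = allᶠ n (λ u → allᶠ n (λ v → not (E u v) ∨ disjoint (lookup κ u) (lookup κ v)))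

  weighted : Fin n → Bool → ℕ
  weighted v b = if b then w v else 0

  addWeight : Vec (List Bool) n → Fin n → List ℕ → List ℕ
  addWeight κ v = zipWith _+_ (map (weighted v) (lookup κ v))

  weights : ℕ → Vec (List Bool) n → List ℕ
  weights k κ = foldrᶠ n (addWeight κ) (replicate k 0)

  valid : ℕ → (Fin n → Bool) → List ℕ → Vec (List Bool) n → Bool
  valid k R α κ = nonemptyOn R κ ∧ proper κ ∧ eqListℕ (weights k κ) α

  count : ℕ → (Fin n → Bool) → List ℕ → ℕ
  count k R α = ∑[ κ ∈ allVecs n (masks k) ] ⟦ valid k R α κ ⟧

  coeff : (Fin n → Bool) → List ℕ → ℕ
  coeff R α = count (length α) R α

  stable : Vec Bool n → Bool
  stable C = allᶠ n (λ u → allᶠ n (λ v → not (E u v) ∨ not (lookup C u ∧ lookup C v)))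

  weight : Vec Bool n → ℕ
  weight C = sumᶠ n (λ v → weighted v (lookup C v))

  stableOfWeight : ℕ → Vec Bool n → ℕ
  stableOfWeight a C = ⟦ stable C ∧ (weight C ≡ᵇ a) ⟧

  _∖_ : (Fin n → Bool) → Vec Bool n → Fin n → Bool
  (R ∖ C) v = R v ∧ not (lookup C v)

  nonemptyOn-∷ : ∀ R C κ → nonemptyOn R (Vec.zipWith _∷_ C κ) ≡ nonemptyOn (R ∖ C) κ
  nonemptyOn-∷ R C κ = allᶠ-cong n λ v → trans
    (cong (λ m → not (R v) ∨ or m) (lookup-zipWith _∷_ v C κ))
    (absorb (R v) (lookup C v) _)
    where
    absorb : ∀ r c x → not r ∨ (c ∨ x) ≡ not (r ∧ not c) ∨ x
    absorb true  true  x = refl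
    absorb true  false x = refl
    absorb false c     x = refl

  proper-∷ : ∀ C κ → proper (Vec.zipWith _∷_ C κ) ≡ stable C ∧ proper κ
  proper-∷ C κ = trans
    (allᶠ-cong n λ u → trans (allᶠ-cong n (pointwise u)) (allᶠ-∧ n _ _))
    (allᶠ-∧ n _ _)
    where
    pointwise : ∀ u v →
      not (E u v) ∨ disjoint (lookup (Vec.zipWith _∷_ C κ) u) (lookup (Vec.zipWith _∷_ C κ) v) ≡
      (not (E u v) ∨ not (lookup C u ∧ lookup C v)) ∧ (not (E u v) ∨ disjoint (lookup κ u) (lookup κ v))
    pointwise u v = begin
      not (E u v) ∨ disjoint (lookup (Vec.zipWith _∷_ C κ) u) (lookup (Vec.zipWith _∷_ C κ) v)
        ≡⟨ cong₂ (λ x y → not (E u v) ∨ disjoint x y) (lookup-zipWith _∷_ u C κ) (lookup-zipWith _∷_ v C κ) ⟩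
      not (E u v) ∨ not ((lookup C u ∧ lookup C v) ∨ or (zipWith _∧_ (lookup κ u) (lookup κ v)))
        ≡⟨ cong (not (E u v) ∨_) (deMorgan₂ (lookup C u ∧ lookup C v) _) ⟩
      not (E u v) ∨ (not (lookup C u ∧ lookup C v) ∧ disjoint (lookup κ u) (lookup κ v))
        ≡⟨ ∨-distribˡ-∧ (not (E u v)) _ _ ⟩
      (not (E u v) ∨ not (lookup C u ∧ lookup C v)) ∧ (not (E u v) ∨ disjoint (lookup κ u) (lookup κ v)) ∎

  weights-∷ : ∀ k C κ → weights (suc k) (Vec.zipWith _∷_ C κ) ≡ weight C ∷ weights k κ
  weights-∷ k C κ = trans
    (foldrᶠ-cong n _ λ v acc → cong (λ m → zipWith _+_ (map (weighted v) m) acc) (lookup-zipWith _∷_ v C κ))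
    (foldrᶠ-zipWith-∷ n weighted (lookup C) (lookup κ) 0 (replicate k 0))

  valid-∷ : ∀ k R a α C κ → valid (suc k) R (a ∷ α) (Vec.zipWith _∷_ C κ) ≡
            (stable C ∧ (weight C ≡ᵇ a)) ∧ valid k (R ∖ C) α κ
  valid-∷ k R a α C κ = begin
    valid (suc k) R (a ∷ α) (Vec.zipWith _∷_ C κ)
      ≡⟨ cong₂ _∧_ (nonemptyOn-∷ R C κ)
                   (cong₂ _∧_ (proper-∷ C κ) (cong (λ ws → eqListℕ ws (a ∷ α)) (weights-∷ k C κ))) ⟩
    nonemptyOn (R ∖ C) κ ∧ (stable C ∧ proper κ) ∧ (weight C ≡ᵇ a) ∧ eqListℕ (weights k κ) α
      ≡⟨ regroup (nonemptyOn (R ∖ C) κ) (stable C) (proper κ) (weight C ≡ᵇ a) _ ⟩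
    (stable C ∧ (weight C ≡ᵇ a)) ∧ valid k (R ∖ C) α κ ∎
    where
    open ∨-∧-Solver using (solve; _:*_; _:=_)
    regroup : ∀ e s p a q → e ∧ (s ∧ p) ∧ a ∧ q ≡ (s ∧ a) ∧ e ∧ p ∧ q
    regroup = solve 5 (λ e s p a q → e :* ((s :* p) :* (a :* q)) := (s :* a) :* (e :* (p :* q))) refl

  classes : List (Vec Bool n)
  classes = allVecs n booleans

  count-∷ : ∀ k R a α →
            count (suc k) R (a ∷ α) ≡ ∑[ C ∈ classes ] (stableOfWeight a C * count k (R ∖ C) α)
  count-∷ k R a α = begin
    count (suc k) R (a ∷ α)
      ≡⟨ ∑-allVecs-zipWith (masks (suc k)) booleans (masks k) _∷_ (∑-masks-suc k) n _ ⟩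
    ∑[ C ∈ classes ] ∑[ κ ∈ allVecs n (masks k) ] ⟦ valid (suc k) R (a ∷ α) (Vec.zipWith _∷_ C κ) ⟧
      ≡⟨ ∑-cong classes (λ C → ∑-cong (allVecs n (masks k)) λ κ →
           trans (cong ⟦_⟧ (valid-∷ k R a α C κ)) (⟦⟧-∧ (stable C ∧ (weight C ≡ᵇ a)) _)) ⟩
    ∑[ C ∈ classes ] ∑[ κ ∈ allVecs n (masks k) ] (stableOfWeight a C * ⟦ valid k (R ∖ C) α κ ⟧)
      ≡⟨ ∑-cong classes (λ C → ∑-distribˡ (stableOfWeight a C) (allVecs n (masks k)) _) ⟩
    ∑[ C ∈ classes ] (stableOfWeight a C * count k (R ∖ C) α) ∎

  count-cong : ∀ k {R R′} α → (∀ v → R v ≡ R′ v) → count k R α ≡ count k R′ α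
  count-cong k α R≗R′ = ∑-cong (allVecs n (masks k)) λ κ →
    cong (λ b → ⟦ b ∧ _ ⟧) (allᶠ-cong n λ v → cong (λ r → not r ∨ _) (R≗R′ v))

  coeff-[] : ∀ R → coeff R [] ≡ ⟦ allᶠ n (not ∘ R) ⟧
  coeff-[] R = begin
    coeff R []
      ≡⟨ ∑-allVecs-singleton n [] _ ⟩
    ⟦ valid 0 R [] uncoloured ⟧
      ≡⟨ cong ⟦_⟧ (cong₂ _∧_ nonemptyOn-uncoloured (cong₂ _∧_ proper-uncoloured weights-uncoloured)) ⟩
    ⟦ allᶠ n (not ∘ R) ∧ true ⟧
      ≡⟨ cong ⟦_⟧ (∧-identityʳ _) ⟩
    ⟦ allᶠ n (not ∘ R) ⟧ ∎
    where
    uncoloured : Vec (List Bool) n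
    uncoloured = Vec.replicate n []
    nonemptyOn-uncoloured : nonemptyOn R uncoloured ≡ allᶠ n (not ∘ R)
    nonemptyOn-uncoloured = allᶠ-cong n λ v →
      trans (cong (λ m → not (R v) ∨ or m) (lookup-replicate v [])) (∨-identityʳ _)
    proper-uncoloured : proper uncoloured ≡ true
    proper-uncoloured = allᶠ-true n λ u → allᶠ-true n λ v → trans
      (cong₂ (λ x y → not (E u v) ∨ disjoint x y) (lookup-replicate u []) (lookup-replicate v []))
      (∨-zeroʳ _)
    weights-uncoloured : eqListℕ (weights 0 uncoloured) [] ≡ true
    weights-uncoloured = cong (λ ws → eqListℕ ws []) (foldrᶠ-fixed n λ v → zipWith-zeroʳ _+_ _)

  weight-empty : ∀ C → isEmpty C ≡ true → weight C ≡ 0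
  weight-empty C C-empty = sumᶠ-zero n λ v → cong (weighted v) (isEmpty-lookup C C-empty v)

  stable-empty : ∀ C → isEmpty C ≡ true → stable C ≡ true
  stable-empty C C-empty = allᶠ-true n λ u → allᶠ-true n λ v →
    trans (cong (λ c → not (E u v) ∨ not (c ∧ lookup C v)) (isEmpty-lookup C C-empty u)) (∨-zeroʳ _)

  ∖-empty : ∀ R v → (R ∖ Vec.replicate n false) v ≡ R v
  ∖-empty R v = trans (cong (λ c → R v ∧ not c) (lookup-replicate v false)) (∧-identityʳ (R v))

  count-∷-∷ : ∀ k R a b α → count (suc (suc k)) R (a ∷ b ∷ α) ≡
    ∑[ C ∈ classes ] ∑[ D ∈ classes ] (stableOfWeight a C * (stableOfWeight b D * count k ((R ∖ C) ∖ D) α))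
  count-∷-∷ k R a b α = begin
    count (suc (suc k)) R (a ∷ b ∷ α)
      ≡⟨ count-∷ (suc k) R a (b ∷ α) ⟩
    ∑[ C ∈ classes ] (stableOfWeight a C * count (suc k) (R ∖ C) (b ∷ α))
      ≡⟨ ∑-cong classes (λ C → cong (stableOfWeight a C *_) (count-∷ k (R ∖ C) b α)) ⟩
    ∑[ C ∈ classes ] (stableOfWeight a C * (∑[ D ∈ classes ] (stableOfWeight b D * count k ((R ∖ C) ∖ D) α)))
      ≡⟨ ∑-cong classes (λ C → ∑-distribˡ (stableOfWeight a C) classes _) ⟨
    ∑[ C ∈ classes ] ∑[ D ∈ classes ] (stableOfWeight a C * (stableOfWeight b D * count k ((R ∖ C) ∖ D) α)) ∎

  coeff-↭ : ∀ {α β} → α ↭ β → ∀ R → coeff R α ≡ coeff R β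
  coeff-↭ ↭.refl        R = refl
  coeff-↭ (↭.trans p q) R = trans (coeff-↭ p R) (coeff-↭ q R)
  coeff-↭ (↭.prep a p)  R = begin
    count _ R (a ∷ _)
      ≡⟨ count-∷ _ R a _ ⟩
    ∑[ C ∈ classes ] (stableOfWeight a C * coeff (R ∖ C) _)
      ≡⟨ ∑-cong classes (λ C → cong (stableOfWeight a C *_) (coeff-↭ p (R ∖ C))) ⟩
    ∑[ C ∈ classes ] (stableOfWeight a C * coeff (R ∖ C) _)
      ≡⟨ count-∷ _ R a _ ⟨
    count _ R (a ∷ _) ∎
  coeff-↭ {a ∷ b ∷ α} {b ∷ a ∷ β} (↭.swap a b p) R = begin
    coeff R (a ∷ b ∷ α)
      ≡⟨ count-∷-∷ _ R a b α ⟩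
    ∑[ C ∈ classes ] ∑[ D ∈ classes ] (stableOfWeight a C * (stableOfWeight b D * coeff ((R ∖ C) ∖ D) α))
      ≡⟨ ∑-swap classes classes _ ⟩
    ∑[ D ∈ classes ] ∑[ C ∈ classes ] (stableOfWeight a C * (stableOfWeight b D * coeff ((R ∖ C) ∖ D) α))
      ≡⟨ ∑-cong classes (λ D → ∑-cong classes λ C → trans
           (*-exchange (stableOfWeight a C) (stableOfWeight b D) (coeff ((R ∖ C) ∖ D) α))
           (cong (λ x → stableOfWeight b D * (stableOfWeight a C * x))
                 (trans (coeff-↭ p _) (count-cong _ β λ v → ∧-exchange (R v) _ _)))) ⟩
    ∑[ D ∈ classes ] ∑[ C ∈ classes ] (stableOfWeight b D * (stableOfWeight a C * coeff ((R ∖ D) ∖ C) β))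
      ≡⟨ count-∷-∷ _ R b a β ⟨
    coeff R (b ∷ a ∷ β) ∎

  properWith : ℕ → List ℕ → Vec (List Bool) n → ℕ
  properWith a μ κ = ⟦ proper κ ∧ eqListℕ (weights a κ) μ ⟧

  countWithSupport : List Bool → ℕ → List ℕ → ℕ
  countWithSupport S a μ = ∑[ κ ∈ allVecs n (masks a) ] (⟦ hasSupport S κ ⟧ * properWith a μ κ)

  jointlyNonempty : Vec (List Bool) n → Vec (List Bool) n → Bool
  jointlyNonempty κ₁ κ₂ = allᶠ n (λ v → or (lookup κ₁ v) ∨ or (lookup κ₂ v))

  module _ {a b : ℕ} (κ₁ κ₂ : Vec (List Bool) n) (lengths : VecAll.All (λ m → length m ≡ a) κ₁) where

    nonemptyOn-++ : nonemptyOn everyVertex (Vec.zipWith _++_ κ₁ κ₂) ≡ jointlyNonempty κ₁ κ₂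
    nonemptyOn-++ = allᶠ-cong n λ v →
      trans (cong or (lookup-zipWith _++_ v κ₁ κ₂)) (or-++ (lookup κ₁ v) (lookup κ₂ v))

    proper-++ : proper (Vec.zipWith _++_ κ₁ κ₂) ≡ proper κ₁ ∧ proper κ₂
    proper-++ = trans (allᶠ-cong n λ u → trans (allᶠ-cong n (pointwise u)) (allᶠ-∧ n _ _)) (allᶠ-∧ n _ _)
      where
      ∣κ₁∣≡a : ∀ v → length (lookup κ₁ v) ≡ a
      ∣κ₁∣≡a = lookup⁺ lengths
      pointwise : ∀ u v →
        not (E u v) ∨ disjoint (lookup (Vec.zipWith _++_ κ₁ κ₂) u) (lookup (Vec.zipWith _++_ κ₁ κ₂) v) ≡
        (not (E u v) ∨ disjoint (lookup κ₁ u) (lookup κ₁ v)) ∧ (not (E u v) ∨ disjoint (lookup κ₂ u) (lookup κ₂ v))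
      pointwise u v = begin
        not (E u v) ∨ disjoint (lookup (Vec.zipWith _++_ κ₁ κ₂) u) (lookup (Vec.zipWith _++_ κ₁ κ₂) v)
          ≡⟨ cong₂ (λ x y → not (E u v) ∨ disjoint x y) (lookup-zipWith _++_ u κ₁ κ₂) (lookup-zipWith _++_ v κ₁ κ₂) ⟩
        not (E u v) ∨ disjoint (lookup κ₁ u ++ lookup κ₂ u) (lookup κ₁ v ++ lookup κ₂ v)
          ≡⟨ cong (not (E u v) ∨_) (disjoint-++ (lookup κ₁ u) _ (lookup κ₁ v) _ (trans (∣κ₁∣≡a u) (sym (∣κ₁∣≡a v)))) ⟩
        not (E u v) ∨ (disjoint (lookup κ₁ u) (lookup κ₁ v) ∧ disjoint (lookup κ₂ u) (lookup κ₂ v))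
          ≡⟨ ∨-distribˡ-∧ (not (E u v)) _ _ ⟩
        (not (E u v) ∨ disjoint (lookup κ₁ u) (lookup κ₁ v)) ∧ (not (E u v) ∨ disjoint (lookup κ₂ u) (lookup κ₂ v)) ∎

    length-weights : length (weights a κ₁) ≡ a
    length-weights = foldrᶠ-preserves n {P = λ acc → length acc ≡ a}
      (λ v → length-addRow (weighted v) (lookup κ₁ v) _ (lookup⁺ lengths v)) (length-replicate a)

    weights-++ : weights (a + b) (Vec.zipWith _++_ κ₁ κ₂) ≡ weights a κ₁ ++ weights b κ₂
    weights-++ = begin
      foldrᶠ n (addWeight (Vec.zipWith _++_ κ₁ κ₂)) (replicate (a + b) 0)
        ≡⟨ foldrᶠ-cong n _ (λ v acc →
             cong (λ m → zipWith _+_ (map (weighted v) m) acc) (lookup-zipWith _++_ v κ₁ κ₂)) ⟩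
      foldrᶠ n (λ v → zipWith _+_ (map (weighted v) (lookup κ₁ v ++ lookup κ₂ v))) (replicate (a + b) 0)
        ≡⟨ cong (foldrᶠ n _) (replicate-+ a b) ⟩
      foldrᶠ n (λ v → zipWith _+_ (map (weighted v) (lookup κ₁ v ++ lookup κ₂ v))) (replicate a 0 ++ replicate b 0)
        ≡⟨ foldrᶠ-zipWith-++ n weighted (lookup κ₁) (lookup κ₂) _ _ (lookup⁺ lengths) (length-replicate a) ⟩
      weights a κ₁ ++ weights b κ₂ ∎

    ⟦valid-++⟧ : ∀ μ ν → length μ ≡ a →
      ⟦ valid (a + b) everyVertex (μ ++ ν) (Vec.zipWith _++_ κ₁ κ₂) ⟧ ≡
      ⟦ jointlyNonempty κ₁ κ₂ ⟧ * (properWith a μ κ₁ * properWith b ν κ₂)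
    ⟦valid-++⟧ μ ν ∣μ∣≡a = begin
      ⟦ valid (a + b) everyVertex (μ ++ ν) (Vec.zipWith _++_ κ₁ κ₂) ⟧
        ≡⟨ cong ⟦_⟧ (cong₂ _∧_ nonemptyOn-++ (cong₂ _∧_ proper-++
             (trans (cong (λ ws → eqListℕ ws (μ ++ ν)) weights-++)
                    (eqListℕ-++ (weights a κ₁) _ μ ν (trans length-weights (sym ∣μ∣≡a)))))) ⟩
      ⟦ jointlyNonempty κ₁ κ₂ ∧ (proper κ₁ ∧ proper κ₂) ∧ (eq₁ ∧ eq₂) ⟧
        ≡⟨ cong (λ x → ⟦ jointlyNonempty κ₁ κ₂ ∧ x ⟧) (∧-interchange (proper κ₁) (proper κ₂) eq₁ eq₂) ⟩
      ⟦ jointlyNonempty κ₁ κ₂ ∧ (proper κ₁ ∧ eq₁) ∧ (proper κ₂ ∧ eq₂) ⟧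
        ≡⟨ ⟦⟧-∧ (jointlyNonempty κ₁ κ₂) _ ⟩
      ⟦ jointlyNonempty κ₁ κ₂ ⟧ * ⟦ (proper κ₁ ∧ eq₁) ∧ (proper κ₂ ∧ eq₂) ⟧
        ≡⟨ cong (⟦ jointlyNonempty κ₁ κ₂ ⟧ *_) (⟦⟧-∧ (proper κ₁ ∧ eq₁) _) ⟩
      ⟦ jointlyNonempty κ₁ κ₂ ⟧ * (properWith a μ κ₁ * properWith b ν κ₂) ∎
      where
      eq₁ = eqListℕ (weights a κ₁) μ
      eq₂ = eqListℕ (weights b κ₂) ν

  jointlyNonempty-∑ : ∀ κ₁ κ₂ → ⟦ jointlyNonempty κ₁ κ₂ ⟧ ≡
    ∑[ S ∈ masks n ] ∑[ T ∈ masks n ] (⟦ hasSupport S κ₁ ⟧ * (⟦ hasSupport T κ₂ ⟧ * ⟦ jointlyCover S T ⟧))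
  jointlyNonempty-∑ κ₁ κ₂ = sym (begin
    ∑[ S ∈ masks n ] ∑[ T ∈ masks n ] (⟦ hasSupport S κ₁ ⟧ * (⟦ hasSupport T κ₂ ⟧ * ⟦ jointlyCover S T ⟧))
      ≡⟨ ∑-cong (masks n) (λ S → ∑-distribˡ ⟦ hasSupport S κ₁ ⟧ (masks n) _) ⟩
    ∑[ S ∈ masks n ] (⟦ hasSupport S κ₁ ⟧ * (∑[ T ∈ masks n ] (⟦ hasSupport T κ₂ ⟧ * ⟦ jointlyCover S T ⟧)))
      ≡⟨ ∑-cong (masks n) (λ S → cong (⟦ hasSupport S κ₁ ⟧ *_) (∑-masks-hasSupport κ₂ _)) ⟩
    ∑[ S ∈ masks n ] (⟦ hasSupport S κ₁ ⟧ * ⟦ jointlyCover S (support κ₂) ⟧)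
      ≡⟨ ∑-masks-hasSupport κ₁ _ ⟩
    ⟦ jointlyCover (support κ₁) (support κ₂) ⟧
      ≡⟨ cong ⟦_⟧ (jointlyCover-support κ₁ κ₂) ⟩
    ⟦ jointlyNonempty κ₁ κ₂ ⟧ ∎)

  ∑-∑-countWithSupport : ∀ S T a b μ ν c →
    ∑[ κ₁ ∈ allVecs n (masks a) ] ∑[ κ₂ ∈ allVecs n (masks b) ]
      ((⟦ hasSupport S κ₁ ⟧ * (⟦ hasSupport T κ₂ ⟧ * c)) * (properWith a μ κ₁ * properWith b ν κ₂)) ≡
    c * (countWithSupport S a μ * countWithSupport T b ν)
  ∑-∑-countWithSupport S T a b μ ν c = begin
    ∑[ κ₁ ∈ allVecs n (masks a) ] ∑[ κ₂ ∈ allVecs n (masks b) ]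
      ((⟦ hasSupport S κ₁ ⟧ * (⟦ hasSupport T κ₂ ⟧ * c)) * (properWith a μ κ₁ * properWith b ν κ₂))
      ≡⟨ ∑-cong (allVecs n (masks a)) (λ κ₁ → ∑-cong (allVecs n (masks b)) λ κ₂ →
           regroup ⟦ hasSupport S κ₁ ⟧ ⟦ hasSupport T κ₂ ⟧ c (properWith a μ κ₁) (properWith b ν κ₂)) ⟩
    ∑[ κ₁ ∈ allVecs n (masks a) ] ∑[ κ₂ ∈ allVecs n (masks b) ] (c * (Q₁ κ₁ * Q₂ κ₂))
      ≡⟨ ∑-cong (allVecs n (masks a)) (λ κ₁ → ∑-distribˡ c (allVecs n (masks b)) _) ⟩
    ∑[ κ₁ ∈ allVecs n (masks a) ] (c * (∑[ κ₂ ∈ allVecs n (masks b) ] (Q₁ κ₁ * Q₂ κ₂)))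
      ≡⟨ ∑-distribˡ c (allVecs n (masks a)) _ ⟩
    c * (∑[ κ₁ ∈ allVecs n (masks a) ] ∑[ κ₂ ∈ allVecs n (masks b) ] (Q₁ κ₁ * Q₂ κ₂))
      ≡⟨ cong (c *_) (∑-*-∑ (allVecs n (masks a)) (allVecs n (masks b)) Q₁ Q₂) ⟨
    c * (countWithSupport S a μ * countWithSupport T b ν) ∎
    where
    Q₁ = λ κ₁ → ⟦ hasSupport S κ₁ ⟧ * properWith a μ κ₁
    Q₂ = λ κ₂ → ⟦ hasSupport T κ₂ ⟧ * properWith b ν κ₂
    regroup : ∀ h₁ h₂ c p₁ p₂ → (h₁ * (h₂ * c)) * (p₁ * p₂) ≡ c * ((h₁ * p₁) * (h₂ * p₂))
    regroup = solve-∀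

  coeff-++ : ∀ μ ν → coeff everyVertex (μ ++ ν) ≡
    ∑ (covers n) (λ (S , T) → countWithSupport S (length μ) μ * countWithSupport T (length ν) ν)
  coeff-++ μ ν = begin
    coeff everyVertex (μ ++ ν)
      ≡⟨ cong (λ k → count k everyVertex (μ ++ ν)) (length-++ μ) ⟩
    count (a + b) everyVertex (μ ++ ν)
      ≡⟨ ∑-allVecs-zipWith (masks (a + b)) (masks a) (masks b) _++_ (∑-masks-+ a b) n _ ⟩
    ∑[ κ₁ ∈ allVecs n (masks a) ] ∑[ κ₂ ∈ allVecs n (masks b) ]
      ⟦ valid (a + b) everyVertex (μ ++ ν) (Vec.zipWith _++_ κ₁ κ₂) ⟧
      ≡⟨ ∑-allVecs-masks-cong n a (λ κ₁ lengths → ∑-cong (allVecs n (masks b)) λ κ₂ →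
           ⟦valid-++⟧ κ₁ κ₂ lengths μ ν refl) ⟩
    ∑[ κ₁ ∈ allVecs n (masks a) ] ∑[ κ₂ ∈ allVecs n (masks b) ]
      (⟦ jointlyNonempty κ₁ κ₂ ⟧ * (properWith a μ κ₁ * properWith b ν κ₂))
      ≡⟨ ∑-cong (allVecs n (masks a)) (λ κ₁ → ∑-cong (allVecs n (masks b)) λ κ₂ → expand κ₁ κ₂) ⟩
    ∑[ κ₁ ∈ allVecs n (masks a) ] ∑[ κ₂ ∈ allVecs n (masks b) ] ∑[ S ∈ masks n ] ∑[ T ∈ masks n ] F S T κ₁ κ₂
      ≡⟨ ∑-∑-swap (allVecs n (masks a)) (allVecs n (masks b)) (masks n) (masks n) _ ⟩
    ∑[ S ∈ masks n ] ∑[ T ∈ masks n ] ∑[ κ₁ ∈ allVecs n (masks a) ] ∑[ κ₂ ∈ allVecs n (masks b) ] F S T κ₁ κ₂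
      ≡⟨ ∑-cong (masks n) (λ S → ∑-cong (masks n) λ T →
           ∑-∑-countWithSupport S T a b μ ν ⟦ jointlyCover S T ⟧) ⟩
    ∑[ S ∈ masks n ] ∑[ T ∈ masks n ]
      (⟦ jointlyCover S T ⟧ * (countWithSupport S a μ * countWithSupport T b ν))
      ≡⟨ ∑-covers n _ ⟨
    ∑ (covers n) (λ (S , T) → countWithSupport S a μ * countWithSupport T b ν) ∎
    where
    a = length μ
    b = length ν

    F : List Bool → List Bool → Vec (List Bool) n → Vec (List Bool) n → ℕ
    F S T κ₁ κ₂ = (⟦ hasSupport S κ₁ ⟧ * (⟦ hasSupport T κ₂ ⟧ * ⟦ jointlyCover S T ⟧)) *
                  (properWith a μ κ₁ * properWith b ν κ₂)

    expand : ∀ κ₁ κ₂ → ⟦ jointlyNonempty κ₁ κ₂ ⟧ * (properWith a μ κ₁ * properWith b ν κ₂) ≡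
             ∑[ S ∈ masks n ] ∑[ T ∈ masks n ] F S T κ₁ κ₂
    expand κ₁ κ₂ = trans (cong (_* P) (jointlyNonempty-∑ κ₁ κ₂)) (sym
      (trans (∑-cong (masks n) (λ S → ∑-distribʳ P (masks n) _)) (∑-distribʳ P (masks n) _)))
      where
      P = properWith a μ κ₁ * properWith b ν κ₂

module _ (Γ : WGraph) where
  open Colourings (adj Γ) (wt Γ)

  validColoring≡valid : ∀ α κ → validColoring Γ α κ ≡ valid (length α) everyVertex α κ
  validColoring≡valid α κ = cong₂ _∧_
    (all-tabulate (n Γ) _ id)
    (cong₂ _∧_
      (trans (all-tabulate (n Γ) _ id) (allᶠ-cong (n Γ) λ u → all-tabulate (n Γ) _ id))
      (cong (λ ws → eqListℕ ws α) (foldr-tabulate (n Γ) _ _ id)))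

  XbarCoeff≡coeff : ∀ α → XbarCoeff Γ α ≡ coeff everyVertex α
  XbarCoeff≡coeff α =
    trans (length-filter (validColoring Γ α) (allVecs (n Γ) (masks (length α))))
          (∑-cong (allVecs (n Γ) (masks (length α))) (cong ⟦_⟧ ∘ validColoring≡valid α))

insertD-↭ : ∀ a l → insertD a l ↭ a ∷ l
insertD-↭ a []      = ↭.refl
insertD-↭ a (b ∷ l) with b ≤ᵇ a
... | true  = ↭.refl
... | false = ↭.trans (↭.prep b (insertD-↭ a l)) (↭.swap b a ↭.refl)

⊔ₚ-↭ : ∀ μ ν → μ ⊔ₚ ν ↭ μ ++ ν
⊔ₚ-↭ []      ν = ↭.refl
⊔ₚ-↭ (a ∷ μ) ν = ↭.trans (insertD-↭ a (μ ⊔ₚ ν)) (↭.prep a (⊔ₚ-↭ μ ν))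

-- The join

=ᶠ-↑ˡ : ∀ {m} k (i j : Fin m) → ((i ↑ˡ k) =ᶠ (j ↑ˡ k)) ≡ (i =ᶠ j)
=ᶠ-↑ˡ k zero    zero    = refl
=ᶠ-↑ˡ k zero    (suc j) = refl
=ᶠ-↑ˡ k (suc i) zero    = refl
=ᶠ-↑ˡ k (suc i) (suc j) = =ᶠ-↑ˡ k i j

=ᶠ-↑ʳ : ∀ m {k} (i j : Fin k) → ((m ↑ʳ i) =ᶠ (m ↑ʳ j)) ≡ (i =ᶠ j)
=ᶠ-↑ʳ zero    i j = refl
=ᶠ-↑ʳ (suc m) i j = =ᶠ-↑ʳ m i j

=ᶠ-↑ˡ-↑ʳ : ∀ {m} k (i : Fin m) (j : Fin k) → ((i ↑ˡ k) =ᶠ (m ↑ʳ j)) ≡ false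
=ᶠ-↑ˡ-↑ʳ k zero    j = refl
=ᶠ-↑ˡ-↑ʳ k (suc i) j = =ᶠ-↑ˡ-↑ʳ k i j

apart : ∀ {p q} → Vec Bool p → Vec Bool q → Bool
apart {p} {q} X Y = allᶠ p (λ u → allᶠ q (λ v → not (lookup X u ∧ lookup Y v)))

apart-emptyˡ : ∀ {p q} (X : Vec Bool p) (Y : Vec Bool q) → isEmpty X ≡ true → apart X Y ≡ true
apart-emptyˡ X Y X-empty = allᶠ-true _ λ u → allᶠ-true _ λ v →
  cong (λ x → not (x ∧ lookup Y v)) (isEmpty-lookup X X-empty u)

apart-emptyʳ : ∀ {p q} (X : Vec Bool p) (Y : Vec Bool q) → isEmpty Y ≡ true → apart X Y ≡ true
apart-emptyʳ X Y Y-empty = allᶠ-true _ λ u → allᶠ-true _ λ v →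
  trans (cong (λ y → not (lookup X u ∧ y)) (isEmpty-lookup Y Y-empty v)) (cong not (∧-zeroʳ _))

apart-nonempty : ∀ {p q} (X : Vec Bool p) (Y : Vec Bool q) →
                 isEmpty X ≡ false → isEmpty Y ≡ false → apart X Y ≡ false
apart-nonempty {p} {q} X Y X-nonempty Y-nonempty
  with allᶠ-false⁻ p X-nonempty | allᶠ-false⁻ q Y-nonempty
... | u , Xu | v , Yv = allᶠ-false p u (allᶠ-false q v
        (cong₂ (λ x y → not (x ∧ y)) (not-injective Xu) (not-injective Yv)))

module Join (G H : WGraph) where
  private
    m = n G
    k = n H

  module G⊎Hᶜ = Colourings (adj (complement (G ⊎ᴳ H))) (wt (G ⊎ᴳ H))
  module Gᶜ   = Colourings (adj (complement G)) (wt G)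
  module Hᶜ   = Colourings (adj (complement H)) (wt H)

  adjᶜ-↑ˡ-↑ˡ : ∀ i j → adj (complement (G ⊎ᴳ H)) (i ↑ˡ k) (j ↑ˡ k) ≡ adj (complement G) i j
  adjᶜ-↑ˡ-↑ˡ i j rewrite splitAt-↑ˡ m i k | splitAt-↑ˡ m j k | =ᶠ-↑ˡ k i j = refl

  adjᶜ-↑ˡ-↑ʳ : ∀ i j → adj (complement (G ⊎ᴳ H)) (i ↑ˡ k) (m ↑ʳ j) ≡ true
  adjᶜ-↑ˡ-↑ʳ i j rewrite splitAt-↑ˡ m i k | splitAt-↑ʳ m k j | =ᶠ-↑ˡ-↑ʳ k i j = refl

  adjᶜ-↑ʳ-↑ˡ : ∀ i j → adj (complement (G ⊎ᴳ H)) (m ↑ʳ i) (j ↑ˡ k) ≡ true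
  adjᶜ-↑ʳ-↑ˡ i j rewrite splitAt-↑ʳ m k i | splitAt-↑ˡ m j k
                       | =ᶠ-sym (m ↑ʳ i) (j ↑ˡ k) | =ᶠ-↑ˡ-↑ʳ k j i = refl

  adjᶜ-↑ʳ-↑ʳ : ∀ i j → adj (complement (G ⊎ᴳ H)) (m ↑ʳ i) (m ↑ʳ j) ≡ adj (complement H) i j
  adjᶜ-↑ʳ-↑ʳ i j rewrite splitAt-↑ʳ m k i | splitAt-↑ʳ m k j | =ᶠ-↑ʳ m i j = refl

  wt-↑ˡ : ∀ i → wt (G ⊎ᴳ H) (i ↑ˡ k) ≡ wt G i
  wt-↑ˡ i rewrite splitAt-↑ˡ m i k = refl

  wt-↑ʳ : ∀ i → wt (G ⊎ᴳ H) (m ↑ʳ i) ≡ wt H i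
  wt-↑ʳ i rewrite splitAt-↑ʳ m k i = refl

  stable-++ : ∀ C₁ C₂ → G⊎Hᶜ.stable (C₁ Vec.++ C₂) ≡
              (Gᶜ.stable C₁ ∧ apart C₁ C₂) ∧ (apart C₂ C₁ ∧ Hᶜ.stable C₂)
  stable-++ C₁ C₂ = trans (allᶠ-+ m k _) (cong₂ _∧_
    (trans (allᶠ-cong m λ u → trans (allᶠ-+ m k _) (cong₂ _∧_
              (allᶠ-cong m λ v → entry (adjᶜ-↑ˡ-↑ˡ u v) (lookup-++ˡ C₁ C₂ u) (lookup-++ˡ C₁ C₂ v))
              (allᶠ-cong k λ v → entry (adjᶜ-↑ˡ-↑ʳ u v) (lookup-++ˡ C₁ C₂ u) (lookup-++ʳ C₁ C₂ v))))
           (allᶠ-∧ m _ _))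
    (trans (allᶠ-cong k λ u → trans (allᶠ-+ m k _) (cong₂ _∧_
              (allᶠ-cong m λ v → entry (adjᶜ-↑ʳ-↑ˡ u v) (lookup-++ʳ C₁ C₂ u) (lookup-++ˡ C₁ C₂ v))
              (allᶠ-cong k λ v → entry (adjᶜ-↑ʳ-↑ʳ u v) (lookup-++ʳ C₁ C₂ u) (lookup-++ʳ C₁ C₂ v))))
           (allᶠ-∧ k _ _)))
    where
    entry : ∀ {e e′ a a′ b b′} → e ≡ e′ → a ≡ a′ → b ≡ b′ → not e ∨ not (a ∧ b) ≡ not e′ ∨ not (a′ ∧ b′)
    entry refl refl refl = refl

  weight-++ : ∀ C₁ C₂ → G⊎Hᶜ.weight (C₁ Vec.++ C₂) ≡ Gᶜ.weight C₁ + Hᶜ.weight C₂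
  weight-++ C₁ C₂ = trans (sumᶠ-+ m k _) (cong₂ _+_
    (sumᶠ-cong m λ v → cong₂ (λ b w → if b then w else 0) (lookup-++ˡ C₁ C₂ v) (wt-↑ˡ v))
    (sumᶠ-cong k λ v → cong₂ (λ b w → if b then w else 0) (lookup-++ʳ C₁ C₂ v) (wt-↑ʳ v)))

  -- The weight is positive, so the empty class, which lies on both sides, does not contribute.
  stableOfWeight-++ : ∀ a C₁ C₂ → G⊎Hᶜ.stableOfWeight (suc a) (C₁ Vec.++ C₂) ≡
    ⟦ isEmpty C₂ ⟧ * Gᶜ.stableOfWeight (suc a) C₁ + ⟦ isEmpty C₁ ⟧ * Hᶜ.stableOfWeight (suc a) C₂
  stableOfWeight-++ a C₁ C₂ rewrite stable-++ C₁ C₂ | weight-++ C₁ C₂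
    with isEmpty C₁ in C₁-empty? | isEmpty C₂ in C₂-empty?
  ... | e₁ | true
    rewrite apart-emptyʳ C₁ C₂ C₂-empty? | apart-emptyˡ C₂ C₁ C₂-empty?
          | Hᶜ.stable-empty C₂ C₂-empty? | Hᶜ.weight-empty C₂ C₂-empty?
          | ∧-identityʳ (Gᶜ.stable C₁ ∧ true) | ∧-identityʳ (Gᶜ.stable C₁)
          | +-identityʳ (Gᶜ.weight C₁) | *-zeroʳ ⟦ e₁ ⟧
    = sym (trans (+-identityʳ _) (+-identityʳ _))
  ... | true | false
    rewrite apart-emptyˡ C₁ C₂ C₁-empty? | apart-emptyʳ C₂ C₁ C₁-empty?
          | Gᶜ.stable-empty C₁ C₁-empty? | Gᶜ.weight-empty C₁ C₁-empty?
    = sym (+-identityʳ _)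
  ... | false | false
    rewrite apart-nonempty C₁ C₂ C₁-empty? C₂-empty? | ∧-zeroʳ (Gᶜ.stable C₁) = refl

  left : (Fin (m + k) → Bool) → Fin m → Bool
  left R = R ∘ (_↑ˡ k)

  right : (Fin (m + k) → Bool) → Fin k → Bool
  right R = R ∘ (m ↑ʳ_)

  productCoeff : (Fin m → Bool) → (Fin k → Bool) → List ℕ → ℕ
  productCoeff Rₗ Rᵣ ν = ∑[ S ∈ masks (length ν) ]
    (Gᶜ.coeff Rₗ (select S ν) * Hᶜ.coeff Rᵣ (select (map not S) ν))

  productCoeff-cong : ∀ {Rₗ Rₗ′ Rᵣ Rᵣ′} ν → (∀ v → Rₗ v ≡ Rₗ′ v) → (∀ v → Rᵣ v ≡ Rᵣ′ v) →
                      productCoeff Rₗ Rᵣ ν ≡ productCoeff Rₗ′ Rᵣ′ ν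
  productCoeff-cong ν Rₗ≗Rₗ′ Rᵣ≗Rᵣ′ = ∑-cong (masks (length ν)) λ S →
    cong₂ _*_ (Gᶜ.count-cong _ _ Rₗ≗Rₗ′) (Hᶜ.count-cong _ _ Rᵣ≗Rᵣ′)

  left-∖ : ∀ R C₁ C₂ v → left (R G⊎Hᶜ.∖ (C₁ Vec.++ C₂)) v ≡ (left R Gᶜ.∖ C₁) v
  left-∖ R C₁ C₂ v = cong (λ c → R (v ↑ˡ k) ∧ not c) (lookup-++ˡ C₁ C₂ v)

  right-∖ : ∀ R C₁ C₂ v → right (R G⊎Hᶜ.∖ (C₁ Vec.++ C₂)) v ≡ (right R Hᶜ.∖ C₂) v
  right-∖ R C₁ C₂ v = cong (λ c → R (m ↑ʳ v) ∧ not c) (lookup-++ʳ C₁ C₂ v)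

  module _ (R : Fin (m + k) → Bool) (a : ℕ) (ν : List ℕ) where

    σᴳ : Vec Bool m → ℕ
    σᴳ = Gᶜ.stableOfWeight (suc a)

    σᴴ : Vec Bool k → ℕ
    σᴴ = Hᶜ.stableOfWeight (suc a)

    later : Vec Bool m → Vec Bool k → ℕ
    later C₁ C₂ = G⊎Hᶜ.coeff (R G⊎Hᶜ.∖ (C₁ Vec.++ C₂)) ν

    firstClassInG : ℕ
    firstClassInG = ∑[ C₁ ∈ Gᶜ.classes ] ∑[ C₂ ∈ Hᶜ.classes ] (⟦ isEmpty C₂ ⟧ * (σᴳ C₁ * later C₁ C₂))

    firstClassInH : ℕ
    firstClassInH = ∑[ C₁ ∈ Gᶜ.classes ] ∑[ C₂ ∈ Hᶜ.classes ] (⟦ isEmpty C₁ ⟧ * (σᴴ C₂ * later C₁ C₂))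

    coeff-∷-join : G⊎Hᶜ.coeff R (suc a ∷ ν) ≡ firstClassInG + firstClassInH
    coeff-∷-join = begin
      G⊎Hᶜ.coeff R (suc a ∷ ν)
        ≡⟨ G⊎Hᶜ.count-∷ _ R (suc a) ν ⟩
      ∑[ C ∈ G⊎Hᶜ.classes ] (G⊎Hᶜ.stableOfWeight (suc a) C * G⊎Hᶜ.coeff (R G⊎Hᶜ.∖ C) ν)
        ≡⟨ ∑-allVecs-++ m k booleans _ ⟩
      ∑[ C₁ ∈ Gᶜ.classes ] ∑[ C₂ ∈ Hᶜ.classes ] (G⊎Hᶜ.stableOfWeight (suc a) (C₁ Vec.++ C₂) * later C₁ C₂)
        ≡⟨ ∑-cong Gᶜ.classes (λ C₁ → trans (∑-cong Hᶜ.classes (split C₁)) (∑-distrib-+ Hᶜ.classes _ _)) ⟩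
      ∑[ C₁ ∈ Gᶜ.classes ]
        ((∑[ C₂ ∈ Hᶜ.classes ] (⟦ isEmpty C₂ ⟧ * (σᴳ C₁ * later C₁ C₂))) +
         (∑[ C₂ ∈ Hᶜ.classes ] (⟦ isEmpty C₁ ⟧ * (σᴴ C₂ * later C₁ C₂))))
        ≡⟨ ∑-distrib-+ Gᶜ.classes _ _ ⟩
      firstClassInG + firstClassInH ∎
      where
      split : ∀ C₁ C₂ → G⊎Hᶜ.stableOfWeight (suc a) (C₁ Vec.++ C₂) * later C₁ C₂ ≡
              ⟦ isEmpty C₂ ⟧ * (σᴳ C₁ * later C₁ C₂) + ⟦ isEmpty C₁ ⟧ * (σᴴ C₂ * later C₁ C₂)
      split C₁ C₂ = begin
        G⊎Hᶜ.stableOfWeight (suc a) (C₁ Vec.++ C₂) * later C₁ C₂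
          ≡⟨ cong (_* later C₁ C₂) (stableOfWeight-++ a C₁ C₂) ⟩
        (⟦ isEmpty C₂ ⟧ * σᴳ C₁ + ⟦ isEmpty C₁ ⟧ * σᴴ C₂) * later C₁ C₂
          ≡⟨ *-distribʳ-+ (later C₁ C₂) (⟦ isEmpty C₂ ⟧ * σᴳ C₁) _ ⟩
        ⟦ isEmpty C₂ ⟧ * σᴳ C₁ * later C₁ C₂ + ⟦ isEmpty C₁ ⟧ * σᴴ C₂ * later C₁ C₂
          ≡⟨ cong₂ _+_ (*-assoc ⟦ isEmpty C₂ ⟧ _ _) (*-assoc ⟦ isEmpty C₁ ⟧ _ _) ⟩
        ⟦ isEmpty C₂ ⟧ * (σᴳ C₁ * later C₁ C₂) + ⟦ isEmpty C₁ ⟧ * (σᴴ C₂ * later C₁ C₂) ∎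

    private
      ∅ : ∀ {p} → Vec Bool p
      ∅ = Vec.replicate _ false

    module _ (ih : ∀ R′ → G⊎Hᶜ.coeff R′ ν ≡ productCoeff (left R′) (right R′) ν) where

      firstClassInG≡ : firstClassInG ≡
        ∑[ S ∈ masks (length ν) ] (Gᶜ.coeff (left R) (suc a ∷ select S ν) * Hᶜ.coeff (right R) (select (map not S) ν))
      firstClassInG≡ = begin
        firstClassInG
          ≡⟨ ∑-cong Gᶜ.classes (λ C₁ → ∑-classes-empty k _) ⟩
        ∑[ C₁ ∈ Gᶜ.classes ] (σᴳ C₁ * later C₁ ∅)
          ≡⟨ ∑-cong Gᶜ.classes (λ C₁ → cong (σᴳ C₁ *_) (trans (ih _) (productCoeff-cong ν
               (left-∖ R C₁ ∅) λ v → trans (right-∖ R C₁ ∅ v) (Hᶜ.∖-empty (right R) v)))) ⟩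
        ∑[ C₁ ∈ Gᶜ.classes ] (σᴳ C₁ * productCoeff (left R Gᶜ.∖ C₁) (right R) ν)
          ≡⟨ ∑-swap-factorʳ Gᶜ.classes (masks (length ν)) σᴳ
               (λ C₁ S → Gᶜ.coeff (left R Gᶜ.∖ C₁) (select S ν)) (λ S → Hᶜ.coeff (right R) (select (map not S) ν)) ⟩
        ∑[ S ∈ masks (length ν) ]
          ((∑[ C₁ ∈ Gᶜ.classes ] (σᴳ C₁ * Gᶜ.coeff (left R Gᶜ.∖ C₁) (select S ν))) *
           Hᶜ.coeff (right R) (select (map not S) ν))
          ≡⟨ ∑-cong (masks (length ν)) (λ S → cong (_* Hᶜ.coeff (right R) (select (map not S) ν))
               (Gᶜ.count-∷ _ (left R) (suc a) (select S ν))) ⟨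
        ∑[ S ∈ masks (length ν) ] (Gᶜ.coeff (left R) (suc a ∷ select S ν) * Hᶜ.coeff (right R) (select (map not S) ν)) ∎

      firstClassInH≡ : firstClassInH ≡
        ∑[ S ∈ masks (length ν) ] (Gᶜ.coeff (left R) (select S ν) * Hᶜ.coeff (right R) (suc a ∷ select (map not S) ν))
      firstClassInH≡ = begin
        firstClassInH
          ≡⟨ ∑-swap Gᶜ.classes Hᶜ.classes _ ⟩
        ∑[ C₂ ∈ Hᶜ.classes ] ∑[ C₁ ∈ Gᶜ.classes ] (⟦ isEmpty C₁ ⟧ * (σᴴ C₂ * later C₁ C₂))
          ≡⟨ ∑-cong Hᶜ.classes (λ C₂ → ∑-classes-empty m _) ⟩
        ∑[ C₂ ∈ Hᶜ.classes ] (σᴴ C₂ * later ∅ C₂)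
          ≡⟨ ∑-cong Hᶜ.classes (λ C₂ → cong (σᴴ C₂ *_) (trans (ih _) (productCoeff-cong ν
               (λ v → trans (left-∖ R ∅ C₂ v) (Gᶜ.∖-empty (left R) v)) (right-∖ R ∅ C₂)))) ⟩
        ∑[ C₂ ∈ Hᶜ.classes ] (σᴴ C₂ * productCoeff (left R) (right R Hᶜ.∖ C₂) ν)
          ≡⟨ ∑-swap-factorˡ Hᶜ.classes (masks (length ν)) σᴴ
               (λ C₂ S → Hᶜ.coeff (right R Hᶜ.∖ C₂) (select (map not S) ν)) (λ S → Gᶜ.coeff (left R) (select S ν)) ⟩
        ∑[ S ∈ masks (length ν) ] (Gᶜ.coeff (left R) (select S ν) *
          (∑[ C₂ ∈ Hᶜ.classes ] (σᴴ C₂ * Hᶜ.coeff (right R Hᶜ.∖ C₂) (select (map not S) ν))))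
          ≡⟨ ∑-cong (masks (length ν)) (λ S → cong (Gᶜ.coeff (left R) (select S ν) *_)
               (Hᶜ.count-∷ _ (right R) (suc a) (select (map not S) ν))) ⟨
        ∑[ S ∈ masks (length ν) ] (Gᶜ.coeff (left R) (select S ν) * Hᶜ.coeff (right R) (suc a ∷ select (map not S) ν)) ∎

  coeff-join : ∀ ν → All (1 ≤_) ν → ∀ R → G⊎Hᶜ.coeff R ν ≡ productCoeff (left R) (right R) ν
  coeff-join [] [] R = begin
    G⊎Hᶜ.coeff R []
      ≡⟨ G⊎Hᶜ.coeff-[] R ⟩
    ⟦ allᶠ (m + k) (not ∘ R) ⟧
      ≡⟨ cong ⟦_⟧ (allᶠ-+ m k _) ⟩
    ⟦ allᶠ m (not ∘ left R) ∧ allᶠ k (not ∘ right R) ⟧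
      ≡⟨ ⟦⟧-∧ (allᶠ m (not ∘ left R)) _ ⟩
    ⟦ allᶠ m (not ∘ left R) ⟧ * ⟦ allᶠ k (not ∘ right R) ⟧
      ≡⟨ cong₂ _*_ (Gᶜ.coeff-[] (left R)) (Hᶜ.coeff-[] (right R)) ⟨
    Gᶜ.coeff (left R) [] * Hᶜ.coeff (right R) []
      ≡⟨ +-identityʳ _ ⟨
    productCoeff (left R) (right R) [] ∎
  coeff-join (suc a ∷ ν) (_ ∷ ν-positive) R = begin
    G⊎Hᶜ.coeff R (suc a ∷ ν)
      ≡⟨ coeff-∷-join R a ν ⟩
    firstClassInG R a ν + firstClassInH R a ν
      ≡⟨ cong₂ _+_ (firstClassInG≡ R a ν ih) (trans (firstClassInH≡ R a ν ih) (sym (+-identityʳ _))) ⟩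
    _ ≡⟨ ∑-masks-suc (length ν) _ ⟨
    productCoeff (left R) (right R) (suc a ∷ ν) ∎
    where
    ih : ∀ R′ → G⊎Hᶜ.coeff R′ ν ≡ productCoeff (left R′) (right R′) ν
    ih = coeff-join ν ν-positive

-- Restriction to an induced subgraph

all-cong : ∀ {p q : A → Bool} (xs : List A) → (∀ x → p x ≡ q x) → all p xs ≡ all q xs
all-cong []       p≗q = refl
all-cong (x ∷ xs) p≗q = cong₂ _∧_ (p≗q x) (all-cong xs p≗q)

all-true : ∀ {p : A → Bool} (xs : List A) → (∀ x → p x ≡ true) → all p xs ≡ true
all-true []       p≡true = refl
all-true (x ∷ xs) p≡true = cong₂ _∧_ (p≡true x) (all-true xs p≡true)

-- Colourings as lists of (vertex , colour set) pairs, so that uncoloured vertices can be deleted.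
colouring : ∀ {p} → List V → Vec (List Bool) p → List (V × List Bool)
colouring xs κ = zip xs (Vec.toList κ)

nonempty : ∀ {p} → Vec (List Bool) p → Bool
nonempty {p} κ = allᶠ p (or ∘ lookup κ)

properᴾ : (V → V → Bool) → List (V × List Bool) → Bool
properᴾ E ps = all (λ p → all (λ q → not (E (proj₁ p) (proj₁ q)) ∨ disjoint (proj₂ p) (proj₂ q)) ps) ps

weightsᴾ : (V → ℕ) → ℕ → List (V × List Bool) → List ℕ
weightsᴾ w k = foldr (λ p → zipWith _+_ (map (λ b → if b then w (proj₁ p) else 0) (proj₂ p))) (replicate k 0)

length-weightsᴾ : ∀ (w : V → ℕ) k ps → length (weightsᴾ w k ps) ≤ k
length-weightsᴾ w k []       = ≤-reflexive (length-replicate k)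
length-weightsᴾ w k (p ∷ ps) = ≤-trans
  (≤-trans (≤-reflexive (length-zipWith _+_ row (weightsᴾ w k ps))) (m⊓n≤n (length row) _))
  (length-weightsᴾ w k ps)
  where
  row = map (λ b → if b then w (proj₁ p) else 0) (proj₂ p)

data DropUncoloured {V : Set} (k : ℕ) : List (V × List Bool) → List (V × List Bool) → Set where
  []   : DropUncoloured k [] []
  keep : ∀ {ps qs} p → DropUncoloured k ps qs → DropUncoloured k (p ∷ ps) (p ∷ qs)
  drop : ∀ {ps qs} v → DropUncoloured k ps qs → DropUncoloured k ((v , replicate k false) ∷ ps) qs

dropNone : ∀ {k} (ps : List (V × List Bool)) → DropUncoloured k ps ps
dropNone []       = []
dropNone (p ∷ ps) = keep p (dropNone ps)

all-dropUncoloured : ∀ {k} {h : V × List Bool → Bool} {ps qs} →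
                     (∀ v → h (v , replicate k false) ≡ true) →
                     DropUncoloured k ps qs → all h ps ≡ all h qs
all-dropUncoloured         h-empty []         = refl
all-dropUncoloured {h = h} h-empty (keep p d) = cong (h p ∧_) (all-dropUncoloured h-empty d)
all-dropUncoloured         h-empty (drop v d) = cong₂ _∧_ (h-empty v) (all-dropUncoloured h-empty d)

properᴾ-dropUncoloured : ∀ {k} (E : V → V → Bool) {ps qs} → DropUncoloured k ps qs →
                         properᴾ E ps ≡ properᴾ E qs
properᴾ-dropUncoloured {k = k} E {ps} {qs} d = trans
  (all-cong ps λ p → all-dropUncoloured
     (λ v → trans (cong (not (E (proj₁ p) v) ∨_) (disjoint-emptyʳ k (proj₂ p))) (∨-zeroʳ _)) d)
  (all-dropUncoloured (λ v → all-true qs λ q →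
     trans (cong (not (E v (proj₁ q)) ∨_) (disjoint-emptyˡ k (proj₂ q))) (∨-zeroʳ _)) d)

weightsᴾ-dropUncoloured : ∀ {k} (w : V → ℕ) {ps qs} → DropUncoloured k ps qs →
                          weightsᴾ w k ps ≡ weightsᴾ w k qs
weightsᴾ-dropUncoloured w [] = refl
weightsᴾ-dropUncoloured w (keep p d) =
  cong (zipWith _+_ (map (λ b → if b then w (proj₁ p) else 0) (proj₂ p))) (weightsᴾ-dropUncoloured w d)
weightsᴾ-dropUncoloured {k = k} w {(v , _) ∷ ps} {qs} (drop v d) = begin
  zipWith _+_ (map (λ b → if b then w v else 0) (replicate k false)) (weightsᴾ w k ps)
    ≡⟨ cong (λ zs → zipWith _+_ zs (weightsᴾ w k ps)) (map-replicate _ k false) ⟩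
  zipWith _+_ (replicate k 0) (weightsᴾ w k ps)
    ≡⟨ zipWith-+-zerosˡ k _ (length-weightsᴾ w k ps) ⟩
  weightsᴾ w k ps
    ≡⟨ weightsᴾ-dropUncoloured w d ⟩
  weightsᴾ w k qs ∎

-- Vertices outside S carry empty colour sets, which F ignores.
∑-restrict : ∀ a (F : List (V × List Bool) → ℕ) → (∀ {ps qs} → DropUncoloured a ps qs → F ps ≡ F qs) →
  ∀ (xs : List V) (S : List Bool) p → length xs ≡ p → length S ≡ p →
  ∑[ κ ∈ allVecs p (masks a) ] (⟦ hasSupport S κ ⟧ * F (colouring xs κ)) ≡
  ∑[ κ ∈ allVecs (length (select S xs)) (masks a) ] (⟦ nonempty κ ⟧ * F (colouring (select S xs) κ))
∑-restrict a F F-drop []       []          zero    _ _ = refl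
∑-restrict a F F-drop (x ∷ xs) (true ∷ S)  (suc p) ∣xs∣ ∣S∣ = begin
  ∑[ κ ∈ allVecs (suc p) (masks a) ] (⟦ hasSupport (true ∷ S) κ ⟧ * F (colouring (x ∷ xs) κ))
    ≡⟨ ∑-allVecs-∷ p (masks a) _ ⟩
  ∑[ m ∈ masks a ] ∑[ κ ∈ allVecs p (masks a) ] (⟦ or m ∧ hasSupport S κ ⟧ * F ((x , m) ∷ colouring xs κ))
    ≡⟨ ∑-cong (masks a) (λ m → ∑-⟦∧⟧ (allVecs p (masks a)) (or m) (hasSupport S) _) ⟩
  ∑[ m ∈ masks a ] (⟦ or m ⟧ * (∑[ κ ∈ allVecs p (masks a) ] (⟦ hasSupport S κ ⟧ * F ((x , m) ∷ colouring xs κ))))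
    ≡⟨ ∑-cong (masks a) (λ m → cong (⟦ or m ⟧ *_) (∑-restrict a (F ∘ ((x , m) ∷_)) (F-drop ∘ keep (x , m))
         xs S p (suc-injective ∣xs∣) (suc-injective ∣S∣))) ⟩
  ∑[ m ∈ masks a ] (⟦ or m ⟧ * (∑[ κ ∈ allVecs r (masks a) ] (⟦ nonempty κ ⟧ * F ((x , m) ∷ colouring vs κ))))
    ≡⟨ ∑-cong (masks a) (λ m → ∑-⟦∧⟧ (allVecs r (masks a)) (or m) nonempty _) ⟨
  ∑[ m ∈ masks a ] ∑[ κ ∈ allVecs r (masks a) ] (⟦ or m ∧ nonempty κ ⟧ * F ((x , m) ∷ colouring vs κ))
    ≡⟨ ∑-allVecs-∷ r (masks a) _ ⟨
  ∑[ κ ∈ allVecs (suc r) (masks a) ] (⟦ nonempty κ ⟧ * F (colouring (x ∷ vs) κ)) ∎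
  where
  vs = select S xs
  r = length vs
∑-restrict a F F-drop (x ∷ xs) (false ∷ S) (suc p) ∣xs∣ ∣S∣ = begin
  ∑[ κ ∈ allVecs (suc p) (masks a) ] (⟦ hasSupport (false ∷ S) κ ⟧ * F (colouring (x ∷ xs) κ))
    ≡⟨ ∑-allVecs-∷ p (masks a) _ ⟩
  ∑[ m ∈ masks a ] ∑[ κ ∈ allVecs p (masks a) ] (⟦ not (or m) ∧ hasSupport S κ ⟧ * F ((x , m) ∷ colouring xs κ))
    ≡⟨ ∑-cong (masks a) (λ m → ∑-⟦∧⟧ (allVecs p (masks a)) (not (or m)) (hasSupport S) _) ⟩
  ∑[ m ∈ masks a ] (⟦ not (or m) ⟧ * (∑[ κ ∈ allVecs p (masks a) ] (⟦ hasSupport S κ ⟧ * F ((x , m) ∷ colouring xs κ))))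
    ≡⟨ ∑-masks-empty a _ ⟩
  ∑[ κ ∈ allVecs p (masks a) ] (⟦ hasSupport S κ ⟧ * F (uncoloured-x ∷ colouring xs κ))
    ≡⟨ ∑-restrict a (F ∘ (uncoloured-x ∷_)) (F-drop ∘ keep _) xs S p (suc-injective ∣xs∣) (suc-injective ∣S∣) ⟩
  ∑[ κ ∈ allVecs r (masks a) ] (⟦ nonempty κ ⟧ * F (uncoloured-x ∷ colouring vs κ))
    ≡⟨ ∑-cong (allVecs r (masks a)) (λ κ → cong (⟦ nonempty κ ⟧ *_) (F-drop (drop x (dropNone _)))) ⟩
  ∑[ κ ∈ allVecs r (masks a) ] (⟦ nonempty κ ⟧ * F (colouring vs κ)) ∎
  where
  vs = select S xs
  r = length vs
  uncoloured-x = (x , replicate a false)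

lookup-select-tabulate : ∀ p (f : Fin p → A) S j → Σ[ t ∈ Fin p ] List.lookup (select S (tabulate f)) j ≡ f t
lookup-select-tabulate zero    f []          ()
lookup-select-tabulate zero    f (true ∷ S)  ()
lookup-select-tabulate zero    f (false ∷ S) ()
lookup-select-tabulate (suc p) f []          ()
lookup-select-tabulate (suc p) f (true ∷ S)  zero    = zero , refl
lookup-select-tabulate (suc p) f (true ∷ S)  (suc j) with lookup-select-tabulate p (f ∘ suc) S j
... | t , eq = suc t , eq
lookup-select-tabulate (suc p) f (false ∷ S) j       with lookup-select-tabulate p (f ∘ suc) S j
... | t , eq = suc t , eq

=ᶠ-lookup-select : ∀ {N} p (f : Fin p → Fin N) → (∀ i j → (f i =ᶠ f j) ≡ (i =ᶠ j)) → ∀ S i j →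
  (List.lookup (select S (tabulate f)) i =ᶠ List.lookup (select S (tabulate f)) j) ≡ (i =ᶠ j)
=ᶠ-lookup-select zero    f f-inj []          () j
=ᶠ-lookup-select zero    f f-inj (true ∷ S)  () j
=ᶠ-lookup-select zero    f f-inj (false ∷ S) () j
=ᶠ-lookup-select (suc p) f f-inj []          () j
=ᶠ-lookup-select (suc p) f f-inj (true ∷ S)  zero    zero    = =ᶠ-refl (f zero)
=ᶠ-lookup-select (suc p) f f-inj (true ∷ S)  zero    (suc j) with lookup-select-tabulate p (f ∘ suc) S j
... | t , eq rewrite eq = f-inj zero (suc t)
=ᶠ-lookup-select (suc p) f f-inj (true ∷ S)  (suc i) zero    with lookup-select-tabulate p (f ∘ suc) S i
... | t , eq rewrite eq = f-inj (suc t) zero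
=ᶠ-lookup-select (suc p) f f-inj (true ∷ S)  (suc i) (suc j) =
  =ᶠ-lookup-select p (f ∘ suc) (λ i j → f-inj (suc i) (suc j)) S i j
=ᶠ-lookup-select (suc p) f f-inj (false ∷ S) i       j       =
  =ᶠ-lookup-select p (f ∘ suc) (λ i j → f-inj (suc i) (suc j)) S i j

colouring-tabulate : ∀ p (f : Fin p → V) (κ : Vec (List Bool) p) →
                     colouring (tabulate f) κ ≡ tabulate (λ i → f i , lookup κ i)
colouring-tabulate zero    f Vec.[]      = refl
colouring-tabulate (suc p) f (x Vec.∷ κ) = cong ((f zero , x) ∷_) (colouring-tabulate p (f ∘ suc) κ)

colouring-lookup : ∀ (xs : List V) (κ : Vec (List Bool) (length xs)) →
                   colouring xs κ ≡ tabulate (λ i → List.lookup xs i , lookup κ i)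
colouring-lookup []       Vec.[]      = refl
colouring-lookup (x ∷ xs) (y Vec.∷ κ) = cong ((x , y) ∷_) (colouring-lookup xs κ)

properᴾ-tabulate : ∀ {V : Set} p (E : V → V → Bool) (g : Fin p → V × List Bool) →
  properᴾ E (tabulate g) ≡
  allᶠ p (λ u → allᶠ p (λ v → not (E (proj₁ (g u)) (proj₁ (g v))) ∨ disjoint (proj₂ (g u)) (proj₂ (g v))))
properᴾ-tabulate p E g = trans (all-tabulate p _ g) (allᶠ-cong p λ u → all-tabulate p _ g)

module Restriction (G : WGraph) (S : List Bool) where
  open Colourings (adj (complement G)) (wt G)
  module G∣Sᶜ = Colourings (adj (complement (restrict G S))) (wt (restrict G S))

  vs : List (Fin (n G))
  vs = select S (allFin (n G))

  properWithᴾ : ℕ → List ℕ → List (Fin (n G) × List Bool) → ℕ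
  properWithᴾ a μ ps = ⟦ properᴾ (adj (complement G)) ps ∧ eqListℕ (weightsᴾ (wt G) a ps) μ ⟧

  properWithᴾ-dropUncoloured : ∀ a μ {ps qs} → DropUncoloured a ps qs →
                               properWithᴾ a μ ps ≡ properWithᴾ a μ qs
  properWithᴾ-dropUncoloured a μ d = cong ⟦_⟧ (cong₂ _∧_
    (properᴾ-dropUncoloured (adj (complement G)) d)
    (cong (λ ws → eqListℕ ws μ) (weightsᴾ-dropUncoloured (wt G) d)))

  properWith≡properWithᴾ : ∀ a μ κ → properWith a μ κ ≡ properWithᴾ a μ (colouring (allFin (n G)) κ)
  properWith≡properWithᴾ a μ κ = sym (begin
    properWithᴾ a μ (colouring (allFin (n G)) κ)
      ≡⟨ cong (properWithᴾ a μ) (colouring-tabulate (n G) id κ) ⟩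
    properWithᴾ a μ (tabulate (λ i → i , lookup κ i))
      ≡⟨ cong ⟦_⟧ (cong₂ _∧_ (properᴾ-tabulate (n G) _ _)
                             (cong (λ ws → eqListℕ ws μ) (foldr-tabulate (n G) _ _ _))) ⟩
    properWith a μ κ ∎)

  adjᶜ-restrict : ∀ i j →
    adj (complement (restrict G S)) i j ≡ adj (complement G) (List.lookup vs i) (List.lookup vs j)
  adjᶜ-restrict i j = cong (λ b → if b then false else not (adj G (List.lookup vs i) (List.lookup vs j)))
    (sym (=ᶠ-lookup-select (n G) id (λ _ _ → refl) S i j))

  valid≡properWithᴾ : ∀ μ κ → ⟦ G∣Sᶜ.valid (length μ) everyVertex μ κ ⟧ ≡
                      ⟦ nonempty κ ⟧ * properWithᴾ (length μ) μ (colouring vs κ)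
  valid≡properWithᴾ μ κ = trans (cong ⟦_⟧ (cong (nonempty κ ∧_) (begin
    G∣Sᶜ.proper κ ∧ eqListℕ (G∣Sᶜ.weights (length μ) κ) μ
      ≡⟨ cong₂ _∧_
           (trans (allᶠ-cong (length vs) λ u → allᶠ-cong (length vs) λ v →
                     cong (λ e → not e ∨ disjoint (lookup κ u) (lookup κ v)) (adjᶜ-restrict u v))
                  (sym (properᴾ-tabulate (length vs) _ _)))
           (cong (λ ws → eqListℕ ws μ) (sym (foldr-tabulate (length vs) _ _ _))) ⟩
    properᴾ (adj (complement G)) (tabulate (λ i → List.lookup vs i , lookup κ i)) ∧
    eqListℕ (weightsᴾ (wt G) (length μ) (tabulate (λ i → List.lookup vs i , lookup κ i))) μ
      ≡⟨ cong (λ ps → properᴾ (adj (complement G)) ps ∧ eqListℕ (weightsᴾ (wt G) (length μ) ps) μ)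
              (colouring-lookup vs κ) ⟨
    properᴾ (adj (complement G)) (colouring vs κ) ∧
    eqListℕ (weightsᴾ (wt G) (length μ) (colouring vs κ)) μ ∎)))
    (⟦⟧-∧ (nonempty κ) _)

  countWithSupport-restrict : ∀ μ → length S ≡ n G →
    countWithSupport S (length μ) μ ≡ XbarCoeff (complement (restrict G S)) μ
  countWithSupport-restrict μ ∣S∣ = begin
    countWithSupport S a μ
      ≡⟨ ∑-cong (allVecs (n G) (masks a)) (λ κ → cong (⟦ hasSupport S κ ⟧ *_) (properWith≡properWithᴾ a μ κ)) ⟩
    ∑[ κ ∈ allVecs (n G) (masks a) ] (⟦ hasSupport S κ ⟧ * properWithᴾ a μ (colouring (allFin (n G)) κ))
      ≡⟨ ∑-restrict a (properWithᴾ a μ) (properWithᴾ-dropUncoloured a μ)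
                    (allFin (n G)) S (n G) (length-tabulate id) ∣S∣ ⟩
    ∑[ κ ∈ allVecs (length vs) (masks a) ] (⟦ nonempty κ ⟧ * properWithᴾ a μ (colouring vs κ))
      ≡⟨ ∑-cong (allVecs (length vs) (masks a)) (sym ∘ valid≡properWithᴾ μ) ⟩
    G∣Sᶜ.coeff everyVertex μ
      ≡⟨ XbarCoeff≡coeff (complement (restrict G S)) μ ⟨
    XbarCoeff (complement (restrict G S)) μ ∎
    where
    a = length μ

-- The coefficients of X̄, and the passage to K

XbarCoeff-⊎ᴳ : ∀ G H ν → All (1 ≤_) ν → XbarCoeff (complement (G ⊎ᴳ H)) ν ≡
  ∑[ S ∈ masks (length ν) ] (XbarCoeff (complement G) (select S ν) * XbarCoeff (complement H) (select (map not S) ν))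
XbarCoeff-⊎ᴳ G H ν ν-positive = trans (XbarCoeff≡coeff (complement (G ⊎ᴳ H)) ν) (trans
  (Join.coeff-join G H ν ν-positive everyVertex)
  (∑-cong (masks (length ν)) λ S → sym (cong₂ _*_
    (XbarCoeff≡coeff (complement G) (select S ν)) (XbarCoeff≡coeff (complement H) (select (map not S) ν)))))

XbarCoeff-⊔ₚ : ∀ G μ ν → XbarCoeff (complement G) (μ ⊔ₚ ν) ≡
  ∑ (covers (n G)) (λ (S , T) → XbarCoeff (complement (restrict G S)) μ * XbarCoeff (complement (restrict G T)) ν)
XbarCoeff-⊔ₚ G μ ν = begin
  XbarCoeff (complement G) (μ ⊔ₚ ν)
    ≡⟨ XbarCoeff≡coeff (complement G) (μ ⊔ₚ ν) ⟩
  coeff everyVertex (μ ⊔ₚ ν)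
    ≡⟨ coeff-↭ (⊔ₚ-↭ μ ν) everyVertex ⟩
  coeff everyVertex (μ ++ ν)
    ≡⟨ coeff-++ μ ν ⟩
  ∑ (covers (n G)) (λ (S , T) → countWithSupport S (length μ) μ * countWithSupport T (length ν) ν)
    ≡⟨ ∑-covers-cong (n G) (λ S T ∣S∣ ∣T∣ → cong₂ _*_
         (Restriction.countWithSupport-restrict G S μ ∣S∣) (Restriction.countWithSupport-restrict G T ν ∣T∣)) ⟩
  ∑ (covers (n G)) (λ (S , T) → XbarCoeff (complement (restrict G S)) μ * XbarCoeff (complement (restrict G T)) ν) ∎
  where
  open Colourings (adj (complement G)) (wt G)

XbarCoeff-[] : ∀ G → XbarCoeff (complement G) [] ≡ ⟦ allᶠ (n G) (λ _ → false) ⟧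
XbarCoeff-[] G =
  trans (XbarCoeff≡coeff (complement G) []) (Colourings.coeff-[] (adj (complement G)) (wt G) everyVertex)

module _ {c ℓ : Level} (K : Field c ℓ) where
  open Field K using (_≈_; 1#; 0#; semiring)
    renaming (_+_ to _+ᴷ_; _*_ to _*ᴷ_; +-cong to +ᴷ-cong; +-identityʳ to +ᴷ-identityʳ;
              refl to ≈-refl; sym to ≈-sym; trans to ≈-trans; reflexive to ≈-reflexive)
  open Sym K
  open import Algebra.Properties.Semiring.Mult semiring using (×-homo-+; ×1-homo-*) renaming (_×_ to _·_)

  fromℕ≡·1# : ∀ k → fromℕ K k ≡ k · 1#
  fromℕ≡·1# zero    = refl
  fromℕ≡·1# (suc k) = cong (1# +ᴷ_) (fromℕ≡·1# k)

  fromℕ-+ : ∀ a b → fromℕ K (a + b) ≈ fromℕ K a +ᴷ fromℕ K b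
  fromℕ-+ a b rewrite fromℕ≡·1# a | fromℕ≡·1# b | fromℕ≡·1# (a + b) = ×-homo-+ 1# a b

  fromℕ-* : ∀ a b → fromℕ K (a * b) ≈ fromℕ K a *ᴷ fromℕ K b
  fromℕ-* a b rewrite fromℕ≡·1# a | fromℕ≡·1# b | fromℕ≡·1# (a * b) = ×1-homo-* a b

  sumK-fromℕ : ∀ {A : Set} (xs : List A) (f g : A → ℕ) →
    sumK K (map (λ x → fromℕ K (f x) *ᴷ fromℕ K (g x)) xs) ≈ fromℕ K (∑[ x ∈ xs ] (f x * g x))
  sumK-fromℕ []       f g = ≈-refl
  sumK-fromℕ (x ∷ xs) f g =
    ≈-trans (+ᴷ-cong (≈-sym (fromℕ-* (f x) (g x))) (sumK-fromℕ xs f g)) (≈-sym (fromℕ-+ (f x * g x) _))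

  Φ-⊎ᴳ : ∀ G H → Φ K (G ⊎ᴳ H) ≋ (Φ K G ⊙ Φ K H)
  Φ-⊎ᴳ G H ν (_ , ν-positive) = ≈-trans
    (≈-reflexive (cong (fromℕ K) (XbarCoeff-⊎ᴳ G H ν ν-positive)))
    (≈-sym (sumK-fromℕ (masks (length ν)) (λ S → XbarCoeff (complement G) (select S ν))
                                          (λ S → XbarCoeff (complement H) (select (map not S) ν))))

  Φ-emptyG : Φ K emptyG ≋ one
  Φ-emptyG []          _                   = +ᴷ-identityʳ 1#
  Φ-emptyG (suc a ∷ ν) (_ , (s≤s z≤n ∷ _)) = ≈-refl

  Φ-Δ : ∀ G → Δ (Φ K G) ≋₂ tensorΣ G (Φ K)
  Φ-Δ G μ ν _ _ = ≈-trans
    (≈-reflexive (cong (fromℕ K) (XbarCoeff-⊔ₚ G μ ν)))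
    (≈-sym (sumK-fromℕ (covers (n G)) (λ (S , _) → XbarCoeff (complement (restrict G S)) μ)
                                      (λ (_ , T) → XbarCoeff (complement (restrict G T)) ν)))

  Φ-counit : ∀ G → counit (Φ K G) ≈ (if n G ≡ᵇ 0 then 1# else 0#)
  Φ-counit G = ≈-trans (≈-reflexive (cong (fromℕ K) (XbarCoeff-[] G))) (fromℕ-⟦allᶠ-false⟧ (n G))
    where
    fromℕ-⟦allᶠ-false⟧ : ∀ p → fromℕ K ⟦ allᶠ p (λ _ → false) ⟧ ≈ (if p ≡ᵇ 0 then 1# else 0#)
    fromℕ-⟦allᶠ-false⟧ zero    = +ᴷ-identityʳ 1#
    fromℕ-⟦allᶠ-false⟧ (suc p) = ≈-refl

proposition8p3 : ∀ {c ℓ : Level} (K : Field c ℓ) → CharZero K →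
    let open Field K
        open Sym K
    in (∀ G H → Φ K (G ⊎ᴳ H) ≋ (Φ K G ⊙ Φ K H))
       × (Φ K emptyG ≋ one)
       × (∀ G → Δ (Φ K G) ≋₂ tensorΣ G (Φ K))
       × (∀ G → counit (Φ K G) ≈ (if n G ≡ᵇ 0 then 1# else 0#))
proposition8p3 K _ = Φ-⊎ᴳ K , Φ-emptyG K , Φ-Δ K , Φ-counit K
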